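{- Let $G$ be an HZ-graph with maximum degree $\Delta\ge 3$, let $r\in V_\Delta$, $s_1\in N_{\Delta-1}(r)$, and let $\varphi$ be an edge $\Delta$-coloring of $G-rs_1$. Then for every typical pseudo-multifan $S=S_\varphi(r,s_1:s_t:s_p)$ (with respect to $rs_1$ and $\varphi$), there exist an edge $\Delta$-coloring $\varphi'$ of $G-rs_t$ and a pseudo-multifan $S^*$ centered at $r$ with respect to $rs_t$ and $\varphi'$ such that $V(S^*)=V(S)$ and $S^*$ is typical 2-inducing (after renaming the colors and relabeling the vertices of $S^*$).
   Context: All graphs are simple. An HZ-graph is a connected graph $G$ of class 2 ($\chi'(G)=\Delta+1$, $\Delta$ the maximum degree) whose core $G_\Delta$ (subgraph induced by degree-$\Delta$ vertices) has maximum degree at most 2. $V_i$ is the set of degree-$i$ vertices, $N_i(v)=N_G(v)\cap V_i$. For an edge $\Delta$-coloring $\varphi$ of $G-e$ (colors $\{1,\dots,\Delta\}$), $\overline{\varphi}(v)$ is the set of colors missing at $v$; a vertex set $X$ is $\varphi$-elementary if the sets $\overline{\varphi}(x)$, $x\in X$, are pairwise disjoint. For an alternating sequence $T$ of vertices and edges, a coloring $\varphi'$ of $G-rs_1$ is $(T,\varphi)$-stable if $\overline{\varphi}'(x)=\overline{\varphi}(x)$ for every vertex $x$ of $T$ and $\varphi'(f)=\varphi(f)$ for every edge $f$ of $T$. Multifan: for an edge $rs_1$ and a coloring $\varphi$ of $G-rs_1$, a multifan centered at $r$ with respect to $rs_1$ and $\varphi$ is a sequence $F_\varphi(r,s_1:s_p)=(r,rs_1,s_1,rs_2,s_2,\dots,rs_p,s_p)$,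 $p\ge1$, of distinct vertices and edges such that for each $i\in[2,p]$ there is $j\in[1,i-1]$ with $\varphi(rs_i)\in\overline{\varphi}(s_j)$; in an HZ-graph it is additionally required that all $s_i$ have degree $\Delta-1$. A multifan is maximum at $r$ if its number of vertices is maximum among all multifans centered at $r$ with respect to $rs$ and $\varphi''$, over all $s\in N_G(r)$ and all edge $\Delta$-colorings $\varphi''$ of $G-rs$. Pseudo-multifan: a sequence $S_\varphi(r,s_1:s_t:s_p)=(r,rs_1,s_1,\dots,rs_t,s_t,rs_{t+1},s_{t+1},\dots,rs_p,s_p)$ of distinct vertices and edges such that (P1) the initial part $F=(r,rs_1,s_1,\dots,rs_t,s_t)$ is a maximum multifan at $r$ (with respect to $rs_1$ and $\varphi$), and (P2) $V(S)$ is $\varphi'$-elementary for every $(F,\varphi)$-stable edge $\Delta$-coloring $\varphi'$ of $G-rs_1$. Typical multifan: a multifan $F=F_\varphi(r,s_1:s_\beta)$ in an HZ-graph is typical (written $F_\varphi(r,s_1:s_\alpha:s_\beta)$ for some $1\le\alpha\le\beta$) if $\overline{\varphi}(r)=\{1\}$, $\overline{\varphi}(s_1)=\{2,\Delta\}$, and, when $\beta\ge 2$: $\varphi(rs_i)=i$ and $\overline{\varphi}(s_i)=\{i+1\}$ for every $i\in[2,\beta]$ with $i\neq\alpha+1$, and if $\beta>\alpha$ then $\varphi(rs_{\alpha+1})=\Delta$ and $\overline{\varphi}(s_{\alpha+1})=\{\alpha+2\}$. It is typical 2-inducing if $\alpha=\beta$. A pseudo-multifan is typical (resp. typical 2-inducing)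 if the maximum multifan $F$ contained in it is typical (resp. typical 2-inducing). -}

module Defs where

open import Data.Nat using (ℕ; zero; suc; _+_; _∸_; _≤_; _<_; _≡ᵇ_)
open import Data.Bool using (Bool; true; false; if_then_else_; _∧_; T)
open import Data.Fin using (Fin)
open import Data.List using (List; map; allFin)
open import Data.Nat.ListAction using (sum)
open import Data.Product using (Σ; _×_; _,_; ∃)
open import Data.Sum using (_⊎_)
open import Relation.Binary.PropositionalEquality using (_≡_; _≢_)
open import Relation.Nullary using (¬_)

record Graph (n : ℕ) : Set where
  field
    adj        : Fin n → Fin n → Bool
    adj-sym    : ∀ u v → adj u v ≡ adj v u
    adj-irrefl : ∀ v → adj v v ≡ false
open Graph public

infix 3 _↔_
_↔_ : Set → Set → Set
A ↔ B = (A → B) × (B → A)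

SameEdge : ∀ {n} → Fin n → Fin n → Fin n → Fin n → Set
SameEdge u v a b = (u ≡ a × v ≡ b) ⊎ (u ≡ b × v ≡ a)

module _ {n : ℕ} (G : Graph n) where
  Edge : Fin n → Fin n → Set
  Edge u v = T (adj G u v)

  deg : Fin n → ℕ
  deg v = sum (map (λ u → if adj G v u then 1 else 0) (allFin n))

  IsMaxDegree : ℕ → Set
  IsMaxDegree Δ = (∀ v → deg v ≤ Δ) × ∃ λ v → deg v ≡ Δ

  data Reach : Fin n → Fin n → Set where
    reach-refl : ∀ {u} → Reach u u
    reach-step : ∀ {u v w} → Edge u v → Reach v w → Reach u w

  Connected : Set
  Connected = ∀ u v → Reach u v

  coreDeg : ℕ → Fin n → ℕ
  coreDeg Δ v = sum (map (λ u → if adj G v u ∧ (deg u ≡ᵇ Δ) then 1 else 0) (allFin n))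

  EdgeMinus : Fin n → Fin n → Fin n → Fin n → Set
  EdgeMinus a b u v = Edge u v × ¬ SameEdge u v a b

-- A proper edge k-coloring (colors 1..k) of the graph with edge relation E.
-- Values of col on non-edges are irrelevant junk.
record EdgeColoring {n : ℕ} (E : Fin n → Fin n → Set) (k : ℕ) : Set where
  field
    col        : Fin n → Fin n → ℕ
    col-sym    : ∀ u v → E u v → col u v ≡ col v u
    col-range  : ∀ u v → E u v → 1 ≤ col u v × col u v ≤ k
    col-proper : ∀ u v w → E u v → E u w → v ≢ w → col u v ≢ col u w
open EdgeColoring public

Missing : ∀ {n} {E : Fin n → Fin n → Set} {k} → EdgeColoring E k → Fin n → ℕ → Set
Missing {E = E} {k} φ x c = (1 ≤ c × c ≤ k) × (∀ u → E x u → col φ x u ≢ c)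

Class2 : ∀ {n} → Graph n → ℕ → Set
Class2 G Δ = ¬ EdgeColoring (Edge G) Δ × EdgeColoring (Edge G) (suc Δ)

IsHZGraph : ∀ {n} → Graph n → ℕ → Set
IsHZGraph G Δ = IsMaxDegree G Δ × Connected G × Class2 G Δ
              × (∀ v → deg G v ≡ Δ → coreDeg G Δ v ≤ 2)

InRange : ℕ → ℕ → ℕ → Set
InRange a b i = a ≤ i × i ≤ b

module HZ {n : ℕ} (G : Graph n) (Δ : ℕ) where

  Col : Fin n → Fin n → Set
  Col a b = EdgeColoring (EdgeMinus G a b) Δ

  -- F_φ(r, s₁ : s_p) with s_i = s i (i ∈ [1,p]); HZ-version (all s_i of degree Δ-1)
  record IsMultifan (r s₁ : Fin n) (φ : Col r s₁) (p : ℕ) (s : ℕ → Fin n) : Set where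
    field
      p≥1      : 1 ≤ p
      first    : s 1 ≡ s₁
      adjacent : ∀ i → InRange 1 p i → Edge G r (s i)
      distinct : ∀ i j → InRange 1 p i → InRange 1 p j → s i ≡ s j → i ≡ j
      degs     : ∀ i → InRange 1 p i → deg G (s i) ≡ Δ ∸ 1
      chain    : ∀ i → InRange 2 p i →
                 ∃ λ j → InRange 1 (i ∸ 1) j × Missing φ (s j) (col φ r (s i))

  IsMaxMultifan : (r s₁ : Fin n) → Col r s₁ → ℕ → (ℕ → Fin n) → Set
  IsMaxMultifan r s₁ φ p s =
    IsMultifan r s₁ φ p s ×
    (∀ (s' : Fin n) (φ'' : Col r s') (p' : ℕ) (t : ℕ → Fin n) →
       Edge G r s' → IsMultifan r s' φ'' p' t → p' ≤ p)

  InV : Fin n → ℕ → (ℕ → Fin n) → Fin n → Set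
  InV r p s x = x ≡ r ⊎ ∃ λ i → InRange 1 p i × s i ≡ x

  Elementary : ∀ {a b} → Col a b → (Fin n → Set) → Set
  Elementary φ X = ∀ x y → X x → X y → x ≢ y → ∀ c → Missing φ x c → ¬ Missing φ y c

  -- φ' is (F,φ)-stable for F = (r, rs₁, s₁, …, rs_t, s_t); rs₁ is uncolored in both
  Stable : (r s₁ : Fin n) → Col r s₁ → ℕ → (ℕ → Fin n) → Col r s₁ → Set
  Stable r s₁ φ t s φ' =
    (∀ x → InV r t s x → ∀ c → Missing φ' x c ↔ Missing φ x c) ×
    (∀ i → InRange 2 t i → col φ' r (s i) ≡ col φ r (s i))

  record IsPseudoMultifan (r s₁ : Fin n) (φ : Col r s₁) (t p : ℕ) (s : ℕ → Fin n) : Set where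
    field
      t≤p        : t ≤ p
      first      : s 1 ≡ s₁
      adjacent   : ∀ i → InRange 1 p i → Edge G r (s i)
      distinct   : ∀ i j → InRange 1 p i → InRange 1 p j → s i ≡ s j → i ≡ j
      maximum    : IsMaxMultifan r s₁ φ t s
      elementary : ∀ (φ' : Col r s₁) → Stable r s₁ φ t s φ' → Elementary φ' (InV r p s)

  Typical : (r s₁ : Fin n) → Col r s₁ → (β : ℕ) → (ℕ → Fin n) → (α : ℕ) → Set
  Typical r s₁ φ β s α =
    InRange 1 β α ×
    (∀ c → Missing φ r c ↔ c ≡ 1) ×
    (∀ c → Missing φ (s 1) c ↔ (c ≡ 2 ⊎ c ≡ Δ)) ×
    (∀ i → InRange 2 β i → i ≢ suc α →
       col φ r (s i) ≡ i × (∀ c → Missing φ (s i) c ↔ c ≡ suc i)) ×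
    (α < β →
       col φ r (s (suc α)) ≡ Δ × (∀ c → Missing φ (s (suc α)) c ↔ c ≡ 2 + α))

  TypicalPseudoMultifan : (r s₁ : Fin n) → Col r s₁ → (t p : ℕ) → (ℕ → Fin n) → Set
  TypicalPseudoMultifan r s₁ φ t p s =
    IsPseudoMultifan r s₁ φ t p s × ∃ λ α → Typical r s₁ φ t s α

  Typical2InducingPseudoMultifan : (r s₁ : Fin n) → Col r s₁ → (t p : ℕ) → (ℕ → Fin n) → Set
  Typical2InducingPseudoMultifan r s₁ φ t p s =
    IsPseudoMultifan r s₁ φ t p s × Typical r s₁ φ t s t

-- Relabel the fan starting from its last vertex, s*ₖ = s (σ k), and recolour G − r sₜ: the edge r s*ₖ gets
-- colour k and every other edge keeps its colour up to one permutation π of the colours. In a typical multifan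
-- the two colours free at sᵢ in G − r sᵢ are 1 + i and the colour E i of r sᵢ (Δ for i = 1); σ and π are chosen
-- so that π maps this pair at s (σ k) onto {k, 1 + k}, and onto {2, Δ} for k = 1, which makes the rotated fan
-- typical 2-inducing. Elementarity is inherited: a colouring that is stable for the rotated fan is recoloured
-- back by π⁻¹ into one that is stable for the original fan, where V(S) is elementary, and off the fan the two
-- colourings differ only by the renaming π.

module Submission where

open import Defs
open import Data.Bool using (true; false)
open import Data.Empty using (⊥; ⊥-elim)
open import Data.Fin using (Fin)
import Data.Fin.Properties as Fin
open import Data.Nat using (ℕ; zero; suc; _+_; _∸_; _≤_; _<_; z≤n; s≤s; _≟_; _≤?_)
open import Data.Nat.Properties
open import Data.Product using (Σ; _×_; _,_; proj₁; proj₂; ∃; map₂)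
open import Data.Sum using (_⊎_; inj₁; inj₂)
open import Relation.Binary.PropositionalEquality
open import Relation.Nullary using (¬_; Dec; yes; no)
open import Relation.Nullary.Decidable using (map′; _×-dec_)

inRange? : ∀ a b c → Dec (InRange a b c)
inRange? a b c with a ≤? c | c ≤? b
... | yes p | yes q = yes (p , q)
... | no p  | _     = no λ x → p (proj₁ x)
... | yes _ | no q  = no λ x → q (proj₂ x)

anyInRange? : ∀ {P : ℕ → Set} → (∀ j → Dec (P j)) → ∀ lo hi → Dec (∃ λ j → InRange lo hi j × P j)
anyInRange? {P} P? lo hi = map′ to from (anyUpTo? (λ j → (lo ≤? j) ×-dec P? j) (suc hi))
  where
  to : (∃ λ j → j < suc hi × lo ≤ j × P j) → ∃ λ j → InRange lo hi j × P j
  to (j , s≤s j≤hi , lo≤j , Pj) = j , (lo≤j , j≤hi) , Pj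
  from : (∃ λ j → InRange lo hi j × P j) → ∃ λ j → j < suc hi × lo ≤ j × P j
  from (j , (lo≤j , j≤hi) , Pj) = j , s≤s j≤hi , lo≤j , Pj

1∉[2,t] : ∀ {t} → ¬ InRange 2 t 1
1∉[2,t] (s≤s () , _)

≢1⇒∈[2,t] : ∀ {k t} → InRange 1 t k → k ≢ 1 → InRange 2 t k
≢1⇒∈[2,t] {zero}        (() , _) _
≢1⇒∈[2,t] {suc zero}    _        k≢1 = ⊥-elim (k≢1 refl)
≢1⇒∈[2,t] {suc (suc k)} (_ , q)  _   = s≤s (s≤s z≤n) , q

∈[2,t]⇒∈[1,t] : ∀ {k t} → InRange 2 t k → InRange 1 t k
∈[2,t]⇒∈[1,t] (p , q) = ≤-trans (s≤s z≤n) p , q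

-- Colour and fan permutations

-- A permutation of [1, N], as two maps of ℕ that are mutually inverse on [1, N]; values outside are junk.
record Permutation (N : ℕ) : Set where
  field
    to from    : ℕ → ℕ
    to-range   : ∀ c → InRange 1 N c → InRange 1 N (to c)
    from-range : ∀ c → InRange 1 N c → InRange 1 N (from c)
    from-to    : ∀ c → InRange 1 N c → from (to c) ≡ c
    to-from    : ∀ c → InRange 1 N c → to (from c) ≡ c

  to-injective : ∀ c c' → InRange 1 N c → InRange 1 N c' → to c ≡ to c' → c ≡ c'
  to-injective c c' rc rc' eq = trans (sym (from-to c rc)) (trans (cong from eq) (from-to c' rc'))

  from-≡ : ∀ c d → InRange 1 N c → to c ≡ d → from d ≡ c
  from-≡ c d rc eq = trans (cong from (sym eq)) (from-to c rc)

  to-≡ : ∀ c d → InRange 1 N d → from d ≡ c → d ≡ to c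
  to-≡ c d rd eq = trans (sym (to-from d rd)) (cong to eq)

inverse : ∀ {N} → Permutation N → Permutation N
inverse π = record
  { to = from ; from = to ; to-range = from-range ; from-range = to-range
  ; from-to = to-from ; to-from = from-to }
  where open Permutation π

widen : ∀ {t p} → t ≤ p → (σ : Permutation t) →
        (∀ k → t < k → Permutation.to σ k ≡ k) → (∀ k → t < k → Permutation.from σ k ≡ k) → Permutation p
widen {t} {p} t≤p σ to-fixed from-fixed = record
  { to = to ; from = from
  ; to-range = range to to-range to-fixed ; from-range = range from from-range from-fixed
  ; from-to = inv from to from-to to-range to-fixed from-fixed
  ; to-from = inv to from to-from from-range from-fixed to-fixed }
  where
  open Permutation σ
  range : (f : ℕ → ℕ) → (∀ c → InRange 1 t c → InRange 1 t (f c)) → (∀ k → t < k → f k ≡ k) →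
          ∀ c → InRange 1 p c → InRange 1 p (f c)
  range f f-range f-fixed c (c≥1 , c≤p) with c ≤? t
  ... | yes c≤t = proj₁ (f-range c (c≥1 , c≤t)) , ≤-trans (proj₂ (f-range c (c≥1 , c≤t))) t≤p
  ... | no c≰t rewrite f-fixed c (≰⇒> c≰t) = c≥1 , c≤p
  inv : (f g : ℕ → ℕ) → (∀ c → InRange 1 t c → f (g c) ≡ c) → (∀ c → InRange 1 t c → InRange 1 t (g c)) →
        (∀ k → t < k → g k ≡ k) → (∀ k → t < k → f k ≡ k) → ∀ c → InRange 1 p c → f (g c) ≡ c
  inv f g fg g-range g-fixed f-fixed c (c≥1 , _) with c ≤? t
  ... | yes c≤t = fg c (c≥1 , c≤t)
  ... | no c≰t rewrite g-fixed c (≰⇒> c≰t) = f-fixed c (≰⇒> c≰t)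

-- The colour of r sᵢ in a typical multifan with α = a, except that i = 1 gives Δ, the colour other than 2
-- missing at s₁. On [1, t] the 2-inducing case a = t coincides with a = 0.
fanColour : ℕ → ℕ → ℕ → ℕ
fanColour Δ a i with i ≟ 1 | i ≟ suc a
... | yes _ | _     = Δ
... | no _  | yes _ = Δ
... | no _  | no _  = i

fanColour-suc : ∀ Δ a → fanColour Δ a (suc a) ≡ Δ
fanColour-suc Δ a with suc a ≟ 1 | suc a ≟ suc a
... | yes _ | _     = refl
... | no _  | yes _ = refl
... | no _  | no ne = ⊥-elim (ne refl)

fanColour-other : ∀ Δ a i → i ≢ 1 → i ≢ suc a → fanColour Δ a i ≡ i
fanColour-other Δ a i i≢1 i≢1+a with i ≟ 1 | i ≟ suc a
... | yes e | _     = ⊥-elim (i≢1 e)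
... | no _  | yes e = ⊥-elim (i≢1+a e)
... | no _  | no _  = refl

fanColour-cases : ∀ Δ a i → fanColour Δ a i ≡ Δ ⊎ fanColour Δ a i ≡ i
fanColour-cases Δ a i with i ≟ 1 | i ≟ suc a
... | yes _ | _     = inj₁ refl
... | no _  | yes _ = inj₁ refl
... | no _  | no _  = inj₂ refl

MapsPairTo : (ℕ → ℕ) → ℕ → ℕ → ℕ → ℕ → Set
MapsPairTo π x y u v = (π x ≡ u × π y ≡ v) ⊎ (π x ≡ v × π y ≡ u)

-- σ relabels the fan and π renames the colours; the colours 1 + σ k and E (σ k) free at s (σ k) are sent to
-- the colours that r s*ₖ and s*ₖ must carry in a typical 2-inducing multifan.
record Rotation (Δ t a : ℕ) : Set where
  field
    colour : Permutation Δ
    fan    : Permutation t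

  π : ℕ → ℕ
  π = Permutation.to colour

  σ : ℕ → ℕ
  σ = Permutation.to fan

  E : ℕ → ℕ
  E = fanColour Δ a

  field
    fan-fixed      : ∀ k → t < k → σ k ≡ k
    fan⁻¹-fixed    : ∀ k → t < k → Permutation.from fan k ≡ k
    fan-first      : σ 1 ≡ t
    colour-first   : π 1 ≡ 1
    colour-pair    : ∀ k → InRange 2 t k → MapsPairTo π (suc (σ k)) (E (σ k)) k (suc k)
    colour-last    : π (suc t) ≡ Δ × π (E t) ≡ 2
    fanColour-onto : ∀ d → InRange 1 Δ d → InRange 2 t (π d) → ∃ λ j → InRange 2 t j × E j ≡ d
    fanColour-into : ∀ j → InRange 2 t j → InRange 2 t (π (E j))

-- With t = a + m, σ reverses [1, m] onto [1 + a, t] and shifts [1 + m, t] down onto [1, a].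
module RotationConstruction (a m Δ : ℕ) (m≥1 : 1 ≤ m) (t<Δ : suc (a + m) < Δ) where

  t : ℕ
  t = a + m

  Colour : ℕ → Set
  Colour = InRange 1 Δ

  m≤t : m ≤ t
  m≤t = m≤n+m m a

  a≤t : a ≤ t
  a≤t = m≤m+n a m

  t≥1 : 1 ≤ t
  t≥1 = ≤-trans m≥1 m≤t

  1+a≤t : suc a ≤ t
  1+a≤t = subst (_≤ t) (+-comm a 1) (+-monoʳ-≤ a m≥1)

  1+t≤Δ : suc t ≤ Δ
  1+t≤Δ = <⇒≤ t<Δ

  t≤Δ : t ≤ Δ
  t≤Δ = ≤-trans (n≤1+n t) 1+t≤Δ

  Δ-colour : Colour Δ
  Δ-colour = ≤-trans (s≤s z≤n) t<Δ , ≤-refl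

  colour-in : ∀ {lo hi c} → 1 ≤ lo → hi ≤ Δ → InRange lo hi c → Colour c
  colour-in p q (x , y) = ≤-trans p x , ≤-trans y q

  reverse-high : ∀ c → InRange (2 + a) t c → InRange 2 m (2 + t ∸ c)
  reverse-high c (p , q) = subst (_≤ 2 + t ∸ c) (m+n∸n≡m 2 t) (∸-monoʳ-≤ (2 + t) q)
                         , subst (2 + t ∸ c ≤_) (m+n∸m≡n (2 + a) m) (∸-monoʳ-≤ (2 + t) p)

  reverse-low : ∀ c → InRange 2 m c → InRange (2 + a) t (2 + t ∸ c)
  reverse-low c (p , q) = subst (_≤ 2 + t ∸ c) (m+n∸n≡m (2 + a) m) (∸-monoʳ-≤ (2 + t) q)
                        , ∸-monoʳ-≤ (2 + t) p

  reverse-reverse : ∀ c → c ≤ 2 + t → 2 + t ∸ (2 + t ∸ c) ≡ c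
  reverse-reverse c = m∸[m∸n]≡n

  ≤2+t : ∀ {c} → c ≤ t → c ≤ 2 + t
  ≤2+t c≤t = ≤-trans c≤t (≤-trans (n≤1+n t) (n≤1+n (suc t)))

  shift-up : ∀ c → InRange 2 (suc a) c → InRange (2 + m) (suc t) (c + m)
  shift-up c (p , q) = +-monoˡ-≤ m p , +-monoˡ-≤ m q

  shift-down : ∀ c → InRange (2 + m) (suc t) c → InRange 2 (suc a) (c ∸ m)
  shift-down c (p , q) = subst (_≤ c ∸ m) (m+n∸n≡m 2 m) (∸-monoˡ-≤ m p)
                       , subst (c ∸ m ≤_) (m+n∸n≡m (suc a) m) (∸-monoˡ-≤ m q)

  cover : ∀ c → 2 ≤ c → c ≤ suc t → InRange (2 + a) t c ⊎ InRange 2 (suc a) c ⊎ c ≡ suc t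
  cover c p q with c ≤? suc a | c ≟ suc t
  ... | yes c≤1+a | _     = inj₂ (inj₁ (p , c≤1+a))
  ... | no _      | yes e = inj₂ (inj₂ e)
  ... | no c≰1+a  | no ne = inj₁ (≰⇒> c≰1+a , ≤-pred (≤∧≢⇒< q ne))

  cover⁻¹ : ∀ c → 2 ≤ c → c ≤ suc t → InRange 2 m c ⊎ c ≡ suc m ⊎ InRange (2 + m) (suc t) c
  cover⁻¹ c p q with c ≤? m | c ≟ suc m
  ... | yes c≤m | _     = inj₁ (p , c≤m)
  ... | no _    | yes e = inj₂ (inj₁ e)
  ... | no c≰m  | no ne = inj₂ (inj₂ (≤∧≢⇒< (≰⇒> c≰m) (λ e → ne (sym e)) , q))

  data ColourView (c v : ℕ) : Set where
    high  : InRange (2 + a) t c → v ≡ 2 + t ∸ c → ColourView c v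
    top   : c ≡ Δ → v ≡ suc m → ColourView c v
    low   : InRange 2 (suc a) c → v ≡ c + m → ColourView c v
    above : c ≡ suc t → v ≡ Δ → ColourView c v
    fixed : ¬ InRange (2 + a) t c → c ≢ Δ → ¬ InRange 2 (suc a) c → c ≢ suc t → v ≡ c → ColourView c v

  π-by : ∀ c → Dec (InRange (2 + a) t c) → Dec (c ≡ Δ) → Dec (InRange 2 (suc a) c) → Dec (c ≡ suc t) → ℕ
  π-by c (yes _) _       _       _       = 2 + t ∸ c
  π-by c (no _)  (yes _) _       _       = suc m
  π-by c (no _)  (no _)  (yes _) _       = c + m
  π-by c (no _)  (no _)  (no _)  (yes _) = Δ
  π-by c (no _)  (no _)  (no _)  (no _)  = c

  π : ℕ → ℕ
  π c = π-by c (inRange? (2 + a) t c) (c ≟ Δ) (inRange? 2 (suc a) c) (c ≟ suc t)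

  view-by : ∀ c d₁ d₂ d₃ d₄ → ColourView c (π-by c d₁ d₂ d₃ d₄)
  view-by c (yes x) _       _       _       = high x refl
  view-by c (no _)  (yes e) _       _       = top e refl
  view-by c (no _)  (no _)  (yes x) _       = low x refl
  view-by c (no _)  (no _)  (no _)  (yes e) = above e refl
  view-by c (no x)  (no y)  (no z)  (no w)  = fixed x y z w refl

  view : ∀ c → ColourView c (π c)
  view c = view-by c (inRange? (2 + a) t c) (c ≟ Δ) (inRange? 2 (suc a) c) (c ≟ suc t)

  data ColourView⁻¹ (c v : ℕ) : Set where
    high  : InRange 2 m c → v ≡ 2 + t ∸ c → ColourView⁻¹ c v
    top   : c ≡ suc m → v ≡ Δ → ColourView⁻¹ c v
    low   : InRange (2 + m) (suc t) c → v ≡ c ∸ m → ColourView⁻¹ c v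
    above : c ≡ Δ → v ≡ suc t → ColourView⁻¹ c v
    fixed : ¬ InRange 2 m c → c ≢ suc m → ¬ InRange (2 + m) (suc t) c → c ≢ Δ → v ≡ c → ColourView⁻¹ c v

  π⁻¹-by : ∀ c → Dec (InRange 2 m c) → Dec (c ≡ suc m) → Dec (InRange (2 + m) (suc t) c) → Dec (c ≡ Δ) → ℕ
  π⁻¹-by c (yes _) _       _       _       = 2 + t ∸ c
  π⁻¹-by c (no _)  (yes _) _       _       = Δ
  π⁻¹-by c (no _)  (no _)  (yes _) _       = c ∸ m
  π⁻¹-by c (no _)  (no _)  (no _)  (yes _) = suc t
  π⁻¹-by c (no _)  (no _)  (no _)  (no _)  = c

  π⁻¹ : ℕ → ℕ
  π⁻¹ c = π⁻¹-by c (inRange? 2 m c) (c ≟ suc m) (inRange? (2 + m) (suc t) c) (c ≟ Δ)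

  view⁻¹-by : ∀ c d₁ d₂ d₃ d₄ → ColourView⁻¹ c (π⁻¹-by c d₁ d₂ d₃ d₄)
  view⁻¹-by c (yes x) _       _       _       = high x refl
  view⁻¹-by c (no _)  (yes e) _       _       = top e refl
  view⁻¹-by c (no _)  (no _)  (yes x) _       = low x refl
  view⁻¹-by c (no _)  (no _)  (no _)  (yes e) = above e refl
  view⁻¹-by c (no x)  (no y)  (no z)  (no w)  = fixed x y z w refl

  view⁻¹ : ∀ c → ColourView⁻¹ c (π⁻¹ c)
  view⁻¹ c = view⁻¹-by c (inRange? 2 m c) (c ≟ suc m) (inRange? (2 + m) (suc t) c) (c ≟ Δ)

  π-high : ∀ c → InRange (2 + a) t c → π c ≡ 2 + t ∸ c
  π-high c x with view c
  ... | high _ e           = e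
  ... | top refl _         = ⊥-elim (<⇒≱ 1+t≤Δ (proj₂ x))
  ... | low y _            = ⊥-elim (<⇒≱ (n<1+n (suc a)) (≤-trans (proj₁ x) (proj₂ y)))
  ... | above refl _       = ⊥-elim (<⇒≱ (n<1+n t) (proj₂ x))
  ... | fixed ¬x _ _ _ _   = ⊥-elim (¬x x)

  π-top : π Δ ≡ suc m
  π-top with view Δ
  ... | high x _           = ⊥-elim (<⇒≱ 1+t≤Δ (proj₂ x))
  ... | top _ e            = e
  ... | low y _            = ⊥-elim (<⇒≱ 1+t≤Δ (≤-trans (proj₂ y) 1+a≤t))
  ... | above e _          = ⊥-elim (<-irrefl (sym e) t<Δ)
  ... | fixed _ Δ≢Δ _ _ _  = ⊥-elim (Δ≢Δ refl)

  π-low : ∀ c → InRange 2 (suc a) c → π c ≡ c + m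
  π-low c y with view c
  ... | high x _           = ⊥-elim (<⇒≱ (n<1+n (suc a)) (≤-trans (proj₁ x) (proj₂ y)))
  ... | top refl _         = ⊥-elim (<⇒≱ 1+t≤Δ (≤-trans (proj₂ y) 1+a≤t))
  ... | low _ e            = e
  ... | above refl _       = ⊥-elim (<⇒≱ 1+a≤t (≤-pred (proj₂ y)))
  ... | fixed _ _ ¬y _ _   = ⊥-elim (¬y y)

  π-above : π (suc t) ≡ Δ
  π-above with view (suc t)
  ... | high x _           = ⊥-elim (<⇒≱ (n<1+n t) (proj₂ x))
  ... | top e _            = ⊥-elim (<-irrefl e t<Δ)
  ... | low y _            = ⊥-elim (<⇒≱ 1+a≤t (≤-pred (proj₂ y)))
  ... | above _ e          = e
  ... | fixed _ _ _ ne _   = ⊥-elim (ne refl)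

  π-first : π 1 ≡ 1
  π-first with view 1
  ... | high (s≤s () , _) _
  ... | top e _            = ⊥-elim (<-irrefl e (≤-trans (s≤s (s≤s z≤n)) t<Δ))
  ... | low (s≤s () , _) _
  ... | above e _          = ⊥-elim (<-irrefl (suc-injective e) t≥1)
  ... | fixed _ _ _ _ e    = e

  π⁻¹-high : ∀ c → InRange 2 m c → π⁻¹ c ≡ 2 + t ∸ c
  π⁻¹-high c x with view⁻¹ c
  ... | high _ e           = e
  ... | top refl _         = ⊥-elim (<⇒≱ (n<1+n m) (proj₂ x))
  ... | low y _            = ⊥-elim (<⇒≱ (m≤n⇒m≤1+n (n<1+n m)) (≤-trans (proj₁ y) (proj₂ x)))
  ... | above refl _       = ⊥-elim (<⇒≱ 1+t≤Δ (≤-trans (proj₂ x) m≤t))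
  ... | fixed ¬x _ _ _ _   = ⊥-elim (¬x x)

  π⁻¹-top : π⁻¹ (suc m) ≡ Δ
  π⁻¹-top with view⁻¹ (suc m)
  ... | high x _           = ⊥-elim (<⇒≱ (n<1+n m) (proj₂ x))
  ... | top _ e            = e
  ... | low y _            = ⊥-elim (<⇒≱ (n<1+n (suc m)) (proj₁ y))
  ... | above e _          = ⊥-elim (<-irrefl e (≤-trans (s≤s (s≤s m≤t)) t<Δ))
  ... | fixed _ ne _ _ _   = ⊥-elim (ne refl)

  π⁻¹-low : ∀ c → InRange (2 + m) (suc t) c → π⁻¹ c ≡ c ∸ m
  π⁻¹-low c y with view⁻¹ c
  ... | high x _           = ⊥-elim (<⇒≱ (m≤n⇒m≤1+n (n<1+n m)) (≤-trans (proj₁ y) (proj₂ x)))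
  ... | top refl _         = ⊥-elim (<⇒≱ (n<1+n (suc m)) (proj₁ y))
  ... | low _ e            = e
  ... | above refl _       = ⊥-elim (<⇒≱ t<Δ (proj₂ y))
  ... | fixed _ _ ¬y _ _   = ⊥-elim (¬y y)

  π⁻¹-above : π⁻¹ Δ ≡ suc t
  π⁻¹-above with view⁻¹ Δ
  ... | high x _           = ⊥-elim (<⇒≱ 1+t≤Δ (≤-trans (proj₂ x) m≤t))
  ... | top e _            = ⊥-elim (<-irrefl (sym e) (≤-trans (s≤s (s≤s m≤t)) t<Δ))
  ... | low y _            = ⊥-elim (<⇒≱ t<Δ (proj₂ y))
  ... | above _ e          = e
  ... | fixed _ _ _ ne _   = ⊥-elim (ne refl)

  π-range : ∀ c → Colour c → Colour (π c)
  π-range c rg with view c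
  ... | high x e         = subst Colour (sym e) (colour-in (s≤s z≤n) (≤-trans m≤t t≤Δ) (reverse-high c x))
  ... | top _ e          = subst Colour (sym e) (s≤s z≤n , ≤-trans (s≤s m≤t) 1+t≤Δ)
  ... | low x e          = subst Colour (sym e) (colour-in (s≤s z≤n) 1+t≤Δ (shift-up c x))
  ... | above _ e        = subst Colour (sym e) Δ-colour
  ... | fixed _ _ _ _ e  = subst Colour (sym e) rg

  π⁻¹-range : ∀ c → Colour c → Colour (π⁻¹ c)
  π⁻¹-range c rg with view⁻¹ c
  ... | high x e         = subst Colour (sym e) (colour-in (s≤s z≤n) t≤Δ (reverse-low c x))
  ... | top _ e          = subst Colour (sym e) Δ-colour
  ... | low x e          = subst Colour (sym e) (colour-in (s≤s z≤n) (≤-trans 1+a≤t t≤Δ) (shift-down c x))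
  ... | above _ e        = subst Colour (sym e) (s≤s z≤n , 1+t≤Δ)
  ... | fixed _ _ _ _ e  = subst Colour (sym e) rg

  π⁻¹∘π : ∀ c → Colour c → π⁻¹ (π c) ≡ c
  π⁻¹∘π c _ with view c
  ... | high x e       = trans (cong π⁻¹ e) (trans (π⁻¹-high _ (reverse-high c x)) (reverse-reverse c (≤2+t (proj₂ x))))
  ... | top refl e     = trans (cong π⁻¹ e) π⁻¹-top
  ... | low x e        = trans (cong π⁻¹ e) (trans (π⁻¹-low _ (shift-up c x)) (m+n∸n≡m c m))
  ... | above refl e   = trans (cong π⁻¹ e) π⁻¹-above
  ... | fixed ¬h c≢Δ ¬l c≢1+t e = trans (cong π⁻¹ e) (fixed⁻¹ (view⁻¹ c))
    where
    outside : 2 ≤ c → c ≤ suc t → ⊥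
    outside p q with cover c p q
    ... | inj₁ x        = ¬h x
    ... | inj₂ (inj₁ x) = ¬l x
    ... | inj₂ (inj₂ x) = c≢1+t x
    fixed⁻¹ : ColourView⁻¹ c (π⁻¹ c) → π⁻¹ c ≡ c
    fixed⁻¹ (high y _)          = ⊥-elim (outside (proj₁ y) (≤-trans (proj₂ y) (≤-trans m≤t (n≤1+n t))))
    fixed⁻¹ (top refl _)        = ⊥-elim (outside (s≤s m≥1) (s≤s m≤t))
    fixed⁻¹ (low y _)           = ⊥-elim (outside (≤-trans (s≤s (s≤s z≤n)) (proj₁ y)) (proj₂ y))
    fixed⁻¹ (above e' _)        = ⊥-elim (c≢Δ e')
    fixed⁻¹ (fixed _ _ _ _ e')  = e'

  π∘π⁻¹ : ∀ c → Colour c → π (π⁻¹ c) ≡ c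
  π∘π⁻¹ c _ with view⁻¹ c
  ... | high x e       = trans (cong π e) (trans (π-high _ (reverse-low c x)) (reverse-reverse c (≤2+t (≤-trans (proj₂ x) m≤t))))
  ... | top refl e     = trans (cong π e) π-top
  ... | low x e        = trans (cong π e) (trans (π-low _ (shift-down c x)) (m∸n+n≡m (≤-trans (m≤n+m m 2) (proj₁ x))))
  ... | above refl e   = trans (cong π e) π-above
  ... | fixed ¬h c≢1+m ¬l c≢Δ e = trans (cong π e) (fixed⁻¹ (view c))
    where
    outside : 2 ≤ c → c ≤ suc t → ⊥
    outside p q with cover⁻¹ c p q
    ... | inj₁ x        = ¬h x
    ... | inj₂ (inj₁ x) = c≢1+m x
    ... | inj₂ (inj₂ x) = ¬l x
    fixed⁻¹ : ColourView c (π c) → π c ≡ c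
    fixed⁻¹ (high y _)          = ⊥-elim (outside (≤-trans (s≤s (s≤s z≤n)) (proj₁ y)) (≤-trans (proj₂ y) (n≤1+n t)))
    fixed⁻¹ (top e' _)          = ⊥-elim (c≢Δ e')
    fixed⁻¹ (low y _)           = ⊥-elim (outside (proj₁ y) (≤-trans (proj₂ y) (s≤s a≤t)))
    fixed⁻¹ (above refl _)      = ⊥-elim (outside (s≤s t≥1) ≤-refl)
    fixed⁻¹ (fixed _ _ _ _ e')  = e'

  colour : Permutation Δ
  colour = record { to = π ; from = π⁻¹ ; to-range = π-range ; from-range = π⁻¹-range
                  ; from-to = π⁻¹∘π ; to-from = π∘π⁻¹ }

  σ-by : ∀ k → Dec (k ≤ m) → Dec (k ≤ t) → ℕ
  σ-by k (yes _) _       = suc t ∸ k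
  σ-by k (no _)  (yes _) = k ∸ m
  σ-by k (no _)  (no _)  = k

  σ : ℕ → ℕ
  σ k = σ-by k (k ≤? m) (k ≤? t)

  σ-low : ∀ k → k ≤ m → σ k ≡ suc t ∸ k
  σ-low k k≤m with k ≤? m
  ... | yes _   = refl
  ... | no k≰m  = ⊥-elim (k≰m k≤m)

  σ-high : ∀ k → m < k → k ≤ t → σ k ≡ k ∸ m
  σ-high k m<k k≤t with k ≤? m | k ≤? t
  ... | yes k≤m | _      = ⊥-elim (<⇒≱ m<k k≤m)
  ... | no _    | yes _  = refl
  ... | no _    | no k≰t = ⊥-elim (k≰t k≤t)

  σ-fixed : ∀ k → t < k → σ k ≡ k
  σ-fixed k t<k with k ≤? m | k ≤? t
  ... | yes k≤m | _       = ⊥-elim (<⇒≱ t<k (≤-trans k≤m m≤t))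
  ... | no _    | yes k≤t = ⊥-elim (<⇒≱ t<k k≤t)
  ... | no _    | no _    = refl

  σ⁻¹-by : ∀ i → Dec (i ≤ a) → Dec (i ≤ t) → ℕ
  σ⁻¹-by i (yes _) _       = i + m
  σ⁻¹-by i (no _)  (yes _) = suc t ∸ i
  σ⁻¹-by i (no _)  (no _)  = i

  σ⁻¹ : ℕ → ℕ
  σ⁻¹ i = σ⁻¹-by i (i ≤? a) (i ≤? t)

  σ⁻¹-low : ∀ i → i ≤ a → σ⁻¹ i ≡ i + m
  σ⁻¹-low i i≤a with i ≤? a
  ... | yes _  = refl
  ... | no i≰a = ⊥-elim (i≰a i≤a)

  σ⁻¹-high : ∀ i → a < i → i ≤ t → σ⁻¹ i ≡ suc t ∸ i
  σ⁻¹-high i a<i i≤t with i ≤? a | i ≤? t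
  ... | yes i≤a | _      = ⊥-elim (<⇒≱ a<i i≤a)
  ... | no _    | yes _  = refl
  ... | no _    | no i≰t = ⊥-elim (i≰t i≤t)

  σ⁻¹-fixed : ∀ i → t < i → σ⁻¹ i ≡ i
  σ⁻¹-fixed i t<i with i ≤? a | i ≤? t
  ... | yes i≤a | _       = ⊥-elim (<⇒≱ t<i (≤-trans i≤a a≤t))
  ... | no _    | yes i≤t = ⊥-elim (<⇒≱ t<i i≤t)
  ... | no _    | no _    = refl

  reverse-fan : ∀ k → 1 ≤ k → k ≤ m → InRange (suc a) t (suc t ∸ k)
  reverse-fan k p q = subst (_≤ suc t ∸ k) (m+n∸n≡m (suc a) m) (∸-monoʳ-≤ (suc t) q) , ∸-monoʳ-≤ (suc t) p

  reverse-fan⁻¹ : ∀ i → a < i → i ≤ t → InRange 1 m (suc t ∸ i)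
  reverse-fan⁻¹ i p q = subst (_≤ suc t ∸ i) (m+n∸n≡m 1 t) (∸-monoʳ-≤ (suc t) q)
                      , subst (suc t ∸ i ≤_) (m+n∸m≡n (suc a) m) (∸-monoʳ-≤ (suc t) p)

  shift-fan : ∀ k → m < k → k ≤ t → InRange 1 a (k ∸ m)
  shift-fan k p q = subst (_≤ k ∸ m) (m+n∸n≡m 1 m) (∸-monoˡ-≤ m p) , subst (k ∸ m ≤_) (m+n∸n≡m a m) (∸-monoˡ-≤ m q)

  σ-range : ∀ k → InRange 1 t k → InRange 1 t (σ k)
  σ-range k (p , q) = cases (k ≤? m)
    where
    cases : Dec (k ≤ m) → InRange 1 t (σ k)
    cases (yes k≤m) = subst (InRange 1 t) (sym (σ-low k k≤m))
                        (≤-trans (s≤s z≤n) (proj₁ (reverse-fan k p k≤m)) , proj₂ (reverse-fan k p k≤m))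
    cases (no k≰m)  = subst (InRange 1 t) (sym (σ-high k (≰⇒> k≰m) q))
                        (proj₁ (shift-fan k (≰⇒> k≰m) q) , ≤-trans (proj₂ (shift-fan k (≰⇒> k≰m) q)) a≤t)

  σ⁻¹-range : ∀ i → InRange 1 t i → InRange 1 t (σ⁻¹ i)
  σ⁻¹-range i (p , q) = cases (i ≤? a)
    where
    cases : Dec (i ≤ a) → InRange 1 t (σ⁻¹ i)
    cases (yes i≤a) = subst (InRange 1 t) (sym (σ⁻¹-low i i≤a)) (≤-trans p (m≤m+n i m) , +-monoˡ-≤ m i≤a)
    cases (no i≰a)  = subst (InRange 1 t) (sym (σ⁻¹-high i (≰⇒> i≰a) q))
                        (proj₁ (reverse-fan⁻¹ i (≰⇒> i≰a) q) , ≤-trans (proj₂ (reverse-fan⁻¹ i (≰⇒> i≰a) q)) m≤t)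

  σ∘σ⁻¹ : ∀ i → InRange 1 t i → σ (σ⁻¹ i) ≡ i
  σ∘σ⁻¹ i (p , q) = cases (i ≤? a)
    where
    cases : Dec (i ≤ a) → σ (σ⁻¹ i) ≡ i
    cases (yes i≤a) = trans (cong σ (σ⁻¹-low i i≤a))
                        (trans (σ-high (i + m) (+-monoˡ-≤ m p) (+-monoˡ-≤ m i≤a)) (m+n∸n≡m i m))
    cases (no i≰a)  = trans (cong σ (σ⁻¹-high i (≰⇒> i≰a) q))
                        (trans (σ-low _ (proj₂ (reverse-fan⁻¹ i (≰⇒> i≰a) q))) (m∸[m∸n]≡n (≤-trans q (n≤1+n t))))

  σ⁻¹∘σ : ∀ k → InRange 1 t k → σ⁻¹ (σ k) ≡ k
  σ⁻¹∘σ k (p , q) = cases (k ≤? m)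
    where
    cases : Dec (k ≤ m) → σ⁻¹ (σ k) ≡ k
    cases (yes k≤m) = trans (cong σ⁻¹ (σ-low k k≤m))
                        (trans (σ⁻¹-high _ (proj₁ (reverse-fan k p k≤m)) (proj₂ (reverse-fan k p k≤m)))
                               (m∸[m∸n]≡n (≤-trans q (n≤1+n t))))
    cases (no k≰m)  = trans (cong σ⁻¹ (σ-high k (≰⇒> k≰m) q))
                        (trans (σ⁻¹-low _ (proj₂ (shift-fan k (≰⇒> k≰m) q))) (m∸n+n≡m (<⇒≤ (≰⇒> k≰m))))

  fan : Permutation t
  fan = record { to = σ ; from = σ⁻¹ ; to-range = σ-range ; from-range = σ⁻¹-range
               ; from-to = σ⁻¹∘σ ; to-from = σ∘σ⁻¹ }

  E : ℕ → ℕ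
  E = fanColour Δ a

  1+[1+t∸k] : ∀ k → k ≤ suc t → suc (suc t ∸ k) ≡ 2 + t ∸ k
  1+[1+t∸k] k k≤1+t = sym (+-∸-assoc 1 k≤1+t)

  colour-pair : ∀ k → InRange 2 t k → MapsPairTo π (suc (σ k)) (E (σ k)) k (suc k)
  colour-pair k (k≥2 , k≤t) = cases (k ≤? m)
    where
    k≥1 : 1 ≤ k
    k≥1 = ≤-trans (s≤s z≤n) k≥2
    cases : Dec (k ≤ m) → MapsPairTo π (suc (σ k)) (E (σ k)) k (suc k)
    cases (yes k≤m) = inj₁ (subst (λ i → π (suc i) ≡ k × π (E i) ≡ suc k) (sym (σ-low k k≤m))
                                  (reversed , freed (k ≟ m)))
      where
      i : ℕ
      i = suc t ∸ k
      reversed : π (suc i) ≡ k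
      reversed = trans (cong π (1+[1+t∸k] k (≤-trans k≤t (n≤1+n t))))
                       (trans (π-high _ (reverse-low k (k≥2 , k≤m))) (reverse-reverse k (≤2+t k≤t)))
      freed : Dec (k ≡ m) → π (E i) ≡ suc k
      freed (yes refl) = trans (cong (λ j → π (E j)) (m+n∸n≡m (suc a) k))
                               (trans (cong π (fanColour-suc Δ a)) π-top)
      freed (no k≢m)   = trans (cong π (fanColour-other Δ a i i≢1 i≢1+a))
                               (trans (π-high i (2+a≤i , proj₂ (reverse-fan k k≥1 k≤m)))
                                      (trans (sym (1+[1+t∸k] i (m∸n≤m (suc t) k)))
                                             (cong suc (m∸[m∸n]≡n (≤-trans k≤t (n≤1+n t))))))
        where
        2+a≤i : 2 + a ≤ i
        2+a≤i = subst (_< i) (m+n∸n≡m (suc a) m) (∸-monoʳ-< (≤∧≢⇒< k≤m k≢m) (≤-trans m≤t (n≤1+n t)))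
        i≢1 : i ≢ 1
        i≢1 e = <⇒≱ (s≤s (s≤s z≤n)) (subst (2 + a ≤_) e 2+a≤i)
        i≢1+a : i ≢ suc a
        i≢1+a e = <⇒≱ (n<1+n (suc a)) (subst (2 + a ≤_) e 2+a≤i)
    cases (no k≰m) = inj₂ (subst (λ i → π (suc i) ≡ suc k × π (E i) ≡ k) (sym (σ-high k m<k k≤t))
                                 (shifted , freed (i ≟ 1)))
      where
      m<k : m < k
      m<k = ≰⇒> k≰m
      i : ℕ
      i = k ∸ m
      i∈[1,a] : InRange 1 a i
      i∈[1,a] = shift-fan k m<k k≤t
      i+m≡k : i + m ≡ k
      i+m≡k = m∸n+n≡m (<⇒≤ m<k)
      shifted : π (suc i) ≡ suc k
      shifted = trans (π-low (suc i) (s≤s (proj₁ i∈[1,a]) , s≤s (proj₂ i∈[1,a]))) (cong suc i+m≡k)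
      freed : Dec (i ≡ 1) → π (E i) ≡ k
      freed (yes i≡1)  = trans (cong (λ j → π (E j)) i≡1) (trans π-top (trans (cong (_+ m) (sym i≡1)) i+m≡k))
      freed (no i≢1)   = trans (cong π (fanColour-other Δ a i i≢1 (λ e → <⇒≱ (n<1+n a) (subst (_≤ a) e (proj₂ i∈[1,a])))))
                               (trans (π-low i (≤∧≢⇒< (proj₁ i∈[1,a]) (λ e → i≢1 (sym e)) , ≤-trans (proj₂ i∈[1,a]) (n≤1+n a)))
                                      i+m≡k)

  colour-last : π (suc t) ≡ Δ × π (E t) ≡ 2
  colour-last = π-above , cases (t ≟ suc a)
    where
    cases : Dec (t ≡ suc a) → π (E t) ≡ 2
    cases (yes t≡1+a) = trans (cong (λ j → π (E j)) t≡1+a)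
                              (trans (cong π (fanColour-suc Δ a)) (trans π-top (cong suc m≡1)))
      where
      m≡1 : m ≡ 1
      m≡1 = +-cancelˡ-≡ a m 1 (trans t≡1+a (+-comm 1 a))
    cases (no t≢1+a) = trans (cong π (fanColour-other Δ a t t≢1 t≢1+a))
                             (trans (π-high t (≤∧≢⇒< 1+a≤t (λ e → t≢1+a (sym e)) , ≤-refl)) (m+n∸n≡m 2 t))
      where
      t≢1 : t ≢ 1
      t≢1 t≡1 = t≢1+a (trans t≡1 (cong suc (sym (n≤0⇒n≡0 a≤0))))
        where
        a≤0 : a ≤ 0
        a≤0 = +-cancelʳ-≤ 1 a 0 (≤-trans (+-monoʳ-≤ a m≥1) (≤-reflexive t≡1))

  E-self : ∀ j → 2 ≤ j → j ≢ suc a → E j ≡ j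
  E-self j j≥2 j≢1+a = fanColour-other Δ a j (λ e → <⇒≱ j≥2 (≤-reflexive e)) j≢1+a

  fanColour-onto : ∀ d → Colour d → InRange 2 t (π d) → ∃ λ j → InRange 2 t j × E j ≡ d
  fanColour-onto d _ π[d]∈[2,t] with view d
  ... | high (p , q) e = d , (≤-trans (s≤s (s≤s z≤n)) p , q) ,
                         E-self d (≤-trans (s≤s (s≤s z≤n)) p) (λ e' → <⇒≱ (n<1+n (suc a)) (subst (2 + a ≤_) e' p))
  ... | top refl e     = suc a , (s≤s a≥1 , 1+a≤t) , fanColour-suc Δ a
    where
    a≥1 : 1 ≤ a
    a≥1 = +-cancelʳ-≤ m 1 a (subst (_≤ t) e (proj₂ π[d]∈[2,t]))
  ... | low (p , _) e  = d , (p , ≤-trans d≤a (≤-trans (n≤1+n a) 1+a≤t)) ,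
                         E-self d p (λ e' → <⇒≱ (n<1+n a) (subst (_≤ a) e' d≤a))
    where
    d≤a : d ≤ a
    d≤a = +-cancelʳ-≤ m d a (subst (_≤ t) e (proj₂ π[d]∈[2,t]))
  ... | above _ e      = ⊥-elim (<⇒≱ 1+t≤Δ (subst (_≤ t) e (proj₂ π[d]∈[2,t])))
  ... | fixed ¬h _ ¬l d≢1+t e with cover d (subst (2 ≤_) e (proj₁ π[d]∈[2,t]))
                                       (≤-trans (subst (_≤ t) e (proj₂ π[d]∈[2,t])) (n≤1+n t))
  ...   | inj₁ x        = ⊥-elim (¬h x)
  ...   | inj₂ (inj₁ x) = ⊥-elim (¬l x)
  ...   | inj₂ (inj₂ x) = ⊥-elim (d≢1+t x)

  fanColour-into : ∀ j → InRange 2 t j → InRange 2 t (π (E j))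
  fanColour-into j (j≥2 , j≤t) = cases (j ≟ suc a)
    where
    cases : Dec (j ≡ suc a) → InRange 2 t (π (E j))
    cases (yes refl)   = subst (InRange 2 t) (sym (trans (cong π (fanColour-suc Δ a)) π-top))
                               (s≤s m≥1 , +-monoˡ-≤ m (≤-pred j≥2))
    cases (no j≢1+a) with cover j j≥2 (≤-trans j≤t (n≤1+n t))
    ... | inj₁ x = subst (InRange 2 t) (sym (trans (cong π (E-self j j≥2 j≢1+a)) (π-high j x)))
                         (proj₁ (reverse-high j x) , ≤-trans (proj₂ (reverse-high j x)) m≤t)
    ... | inj₂ (inj₁ (p , q)) = subst (InRange 2 t) (sym (trans (cong π (E-self j j≥2 j≢1+a)) (π-low j (p , q))))
                                      (≤-trans p (m≤m+n j m) , +-monoˡ-≤ m (≤-pred (≤∧≢⇒< q j≢1+a)))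
    ... | inj₂ (inj₂ e) = ⊥-elim (<⇒≱ (n<1+n t) (subst (_≤ t) e j≤t))

  rotation : Rotation Δ t a
  rotation = record
    { colour = colour ; fan = fan ; fan-fixed = σ-fixed ; fan⁻¹-fixed = σ⁻¹-fixed
    ; fan-first = σ-low 1 m≥1 ; colour-first = π-first
    ; colour-pair = colour-pair ; colour-last = colour-last
    ; fanColour-onto = fanColour-onto ; fanColour-into = fanColour-into }

rotation-below : ∀ {Δ a t} → a < t → suc t < Δ → Rotation Δ t a
rotation-below {Δ} {a} {t} a<t t<Δ =
  subst (λ t → Rotation Δ t a) a+[t∸a]≡t
        (RotationConstruction.rotation a (t ∸ a) Δ (m<n⇒0<n∸m a<t) (subst (λ t → suc t < Δ) (sym a+[t∸a]≡t) t<Δ))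
  where
  a+[t∸a]≡t : a + (t ∸ a) ≡ t
  a+[t∸a]≡t = m+[n∸m]≡n (<⇒≤ a<t)

rotation-2inducing : ∀ {Δ t} → 1 ≤ t → suc t < Δ → Rotation Δ t 0
rotation-2inducing {Δ} {t} = RotationConstruction.rotation 0 t Δ

-- Recolouring a fan

module Centred {n : ℕ} (G : Graph n) (Δ : ℕ) (r : Fin n) where
  open HZ G Δ

  Colour : ℕ → Set
  Colour = InRange 1 Δ

  edge-irrefl : ∀ {x} → ¬ Edge G x x
  edge-irrefl {x} e with adj G x x | adj-irrefl G x
  ... | false | _ = e
  ... | true  | ()

  edge-sym : ∀ {x y} → Edge G x y → Edge G y x
  edge-sym {x} {y} e rewrite adj-sym G y x = e

  edge-≢ : ∀ {x y} → Edge G x y → x ≢ y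
  edge-≢ e refl = edge-irrefl e

  centre-≢ : ∀ {x} → Edge G r x → x ≢ r
  centre-≢ e x≡r = edge-≢ e (sym x≡r)

  off-centre : ∀ {a u v} → Edge G u v → u ≢ r → v ≢ r → EdgeMinus G r a u v
  off-centre e u≢r v≢r = e , λ { (inj₁ (u≡r , _)) → u≢r u≡r ; (inj₂ (_ , v≡r)) → v≢r v≡r }

  from-centre : ∀ {a u} → Edge G r u → u ≢ a → EdgeMinus G r a r u
  from-centre e u≢a = e , λ { (inj₁ (_ , u≡a)) → u≢a u≡a ; (inj₂ (_ , u≡r)) → centre-≢ e u≡r }

  to-centre : ∀ {a u} → Edge G r u → u ≢ a → EdgeMinus G r a u r
  to-centre e u≢a = edge-sym e , λ { (inj₁ (u≡r , _)) → centre-≢ e u≡r ; (inj₂ (u≡a , _)) → u≢a u≡a }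

  FreeOffCentre : ∀ {a b} → Col a b → Fin n → ℕ → Set
  FreeOffCentre ψ x c = ∀ u → Edge G x u → u ≢ r → col ψ x u ≢ c

  missing-neighbour : ∀ {a} (ψ : Col r a) x c → Edge G r x →
                      Missing ψ x c ↔ (Colour c × (x ≢ a → col ψ r x ≢ c) × FreeOffCentre ψ x c)
  missing-neighbour {a} ψ x c erx = to , from
    where
    to : Missing ψ x c → Colour c × (x ≢ a → col ψ r x ≢ c) × FreeOffCentre ψ x c
    to (rg , free) = rg , (λ x≢a eq → free r (to-centre erx x≢a) (trans (col-sym ψ x r (to-centre erx x≢a)) eq))
                        , (λ u exu u≢r → free u (off-centre exu (centre-≢ erx) u≢r))
    from : Colour c × (x ≢ a → col ψ r x ≢ c) × FreeOffCentre ψ x c → Missing ψ x c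
    from (rg , centre-free , off-free) = rg , free
      where
      free : ∀ u → EdgeMinus G r a x u → col ψ x u ≢ c
      free u (exu , ns) with u Fin.≟ r
      ... | no u≢r   = off-free u exu u≢r
      ... | yes refl = λ eq → centre-free x≢a (trans (col-sym ψ r x (from-centre erx x≢a)) eq)
        where
        x≢a : x ≢ a
        x≢a x≡a = ns (inj₂ (x≡a , refl))

  freeOffCentre⇔ : ∀ {a} (ψ : Col r a) x c → Edge G r x → Colour c →
                   FreeOffCentre ψ x c ↔ (Missing ψ x c ⊎ (x ≢ a × col ψ r x ≡ c))
  freeOffCentre⇔ {a} ψ x c erx rg = to , from
    where
    to : FreeOffCentre ψ x c → Missing ψ x c ⊎ (x ≢ a × col ψ r x ≡ c)
    to free with x Fin.≟ a | col ψ r x ≟ c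
    ... | no x≢a  | yes eq = inj₂ (x≢a , eq)
    ... | yes x≡a | _      = inj₁ (proj₂ (missing-neighbour ψ x c erx) (rg , (λ x≢a → ⊥-elim (x≢a x≡a)) , free))
    ... | no _    | no ne  = inj₁ (proj₂ (missing-neighbour ψ x c erx) (rg , (λ _ → ne) , free))
    from : Missing ψ x c ⊎ (x ≢ a × col ψ r x ≡ c) → FreeOffCentre ψ x c
    from (inj₁ m) = proj₂ (proj₂ (proj₁ (missing-neighbour ψ x c erx) m))
    from (inj₂ (x≢a , eq)) u exu u≢r eq' =
      col-proper ψ x u r (off-centre exu (centre-≢ erx) u≢r) (to-centre erx x≢a) u≢r
        (trans eq' (trans (sym eq) (col-sym ψ r x (from-centre erx x≢a))))

  InFan : (ℕ → Fin n) → ℕ → Fin n → Set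
  InFan f t x = ∃ λ k → InRange 1 t k × f k ≡ x

  inFan? : ∀ f t x → Dec (InFan f t x)
  inFan? f t x = anyInRange? (λ k → f k Fin.≟ x) 1 t

  FreeOffFan : ∀ {a b} → (ℕ → Fin n) → ℕ → Col a b → ℕ → Set
  FreeOffFan f t ψ c = ∀ u → Edge G r u → ¬ InFan f t u → col ψ r u ≢ c

  Neighbours : (ℕ → Fin n) → ℕ → Set
  Neighbours f t = ∀ k → InRange 1 t k → Edge G r (f k)

  Distinct : (ℕ → Fin n) → ℕ → Set
  Distinct f t = ∀ i j → InRange 1 t i → InRange 1 t j → f i ≡ f j → i ≡ j

  missing-centre : ∀ {b} (ψ : Col r b) f t → f 1 ≡ b → 1 ≤ t → Neighbours f t → Distinct f t → ∀ c →
                   Missing ψ r c ↔ (Colour c × (∀ k → InRange 2 t k → col ψ r (f k) ≢ c) × FreeOffFan f t ψ c)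
  missing-centre {b} ψ f t f1≡b t≥1 nbr dist c = to , from
    where
    1∈[1,t] : InRange 1 t 1
    1∈[1,t] = ≤-refl , t≥1
    fk≢b : ∀ {k} → InRange 2 t k → f k ≢ b
    fk≢b k∈ fk≡b = 1∉[2,t] (subst (InRange 2 t) (dist _ 1 (∈[2,t]⇒∈[1,t] k∈) 1∈[1,t] (trans fk≡b (sym f1≡b))) k∈)
    u≢b : ∀ {u} → ¬ InFan f t u → u ≢ b
    u≢b u∉ u≡b = u∉ (1 , 1∈[1,t] , trans f1≡b (sym u≡b))
    to : Missing ψ r c → Colour c × (∀ k → InRange 2 t k → col ψ r (f k) ≢ c) × FreeOffFan f t ψ c
    to (rg , free) = rg , (λ k k∈ → free (f k) (from-centre (nbr k (∈[2,t]⇒∈[1,t] k∈)) (fk≢b k∈)))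
                        , (λ u eru u∉ → free u (from-centre eru (u≢b u∉)))
    from : Colour c × (∀ k → InRange 2 t k → col ψ r (f k) ≢ c) × FreeOffFan f t ψ c → Missing ψ r c
    from (rg , fan-free , off-free) = rg , free
      where
      free : ∀ u → EdgeMinus G r b r u → col ψ r u ≢ c
      free u (eru , ns) with inFan? f t u
      ... | no u∉ = off-free u eru u∉
      ... | yes (k , k∈ , refl) with k ≟ 1
      ... | yes refl = ⊥-elim (ns (inj₁ (refl , f1≡b)))
      ... | no k≢1   = fan-free k (≢1⇒∈[2,t] k∈ k≢1)

  module FanRecolouring
    {a b : Fin n} (χ : Col r a) (f : ℕ → Fin n) (t : ℕ)
    (f1≡b : f 1 ≡ b) (t≥1 : 1 ≤ t) (nbr : Neighbours f t) (dist : Distinct f t) (a∈fan : InFan f t a)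
    (π : Permutation Δ) (κ : ℕ → ℕ)
    (κ-colour : ∀ k → InRange 2 t k → Colour (κ k))
    (κ-injective : ∀ k k' → InRange 2 t k → InRange 2 t k' → κ k ≡ κ k' → k ≡ k')
    (κ-free-off-fan : ∀ u → Edge G r u → ¬ InFan f t u → ∀ k → InRange 2 t k → Permutation.to π (col χ r u) ≢ κ k)
    (κ-free-at-fan : ∀ k → InRange 2 t k → ∀ u → Edge G (f k) u → u ≢ r → Permutation.to π (col χ (f k) u) ≢ κ k)
    where

    open Permutation π renaming (to to π⁺; from to π⁻)

    centreColour : Fin n → ℕ
    centreColour w with inFan? f t w
    ... | yes (k , _) = κ k
    ... | no _        = π⁺ (col χ r w)

    recol : Fin n → Fin n → ℕ
    recol u v with u Fin.≟ r | v Fin.≟ r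
    ... | yes _ | _     = centreColour v
    ... | no _  | yes _ = centreColour u
    ... | no _  | no _  = π⁺ (col χ u v)

    centreColour-fan : ∀ k → InRange 1 t k → centreColour (f k) ≡ κ k
    centreColour-fan k k∈ with inFan? f t (f k)
    ... | yes (k' , k'∈ , e) = cong κ (dist k' k k'∈ k∈ e)
    ... | no k∉              = ⊥-elim (k∉ (k , k∈ , refl))

    centreColour-off-fan : ∀ w → ¬ InFan f t w → centreColour w ≡ π⁺ (col χ r w)
    centreColour-off-fan w w∉ with inFan? f t w
    ... | yes w∈ = ⊥-elim (w∉ w∈)
    ... | no _   = refl

    recol-centre : ∀ v → recol r v ≡ centreColour v
    recol-centre v with r Fin.≟ r
    ... | yes _ = refl
    ... | no ne = ⊥-elim (ne refl)

    recol-to-centre : ∀ u → u ≢ r → recol u r ≡ centreColour u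
    recol-to-centre u u≢r with u Fin.≟ r | r Fin.≟ r
    ... | yes e | _     = ⊥-elim (u≢r e)
    ... | no _  | yes _ = refl
    ... | no _  | no ne = ⊥-elim (ne refl)

    recol-off-centre : ∀ u v → u ≢ r → v ≢ r → recol u v ≡ π⁺ (col χ u v)
    recol-off-centre u v u≢r v≢r with u Fin.≟ r | v Fin.≟ r
    ... | yes e | _     = ⊥-elim (u≢r e)
    ... | no _  | yes e = ⊥-elim (v≢r e)
    ... | no _  | no _  = refl

    ≢a-off-fan : ∀ {w} → ¬ InFan f t w → w ≢ a
    ≢a-off-fan w∉ refl = w∉ a∈fan

    b∈fan : InFan f t b
    b∈fan = 1 , (≤-refl , t≥1) , f1≡b

    ≢b⇒∈[2,t] : ∀ {k} → InRange 1 t k → f k ≢ b → InRange 2 t k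
    ≢b⇒∈[2,t] k∈ fk≢b = ≢1⇒∈[2,t] k∈ λ { refl → fk≢b f1≡b }

    χ-colour : ∀ {u v} → EdgeMinus G r a u v → Colour (col χ u v)
    χ-colour {u} {v} e = col-range χ u v e

    π-injective : ∀ {u v u' v'} → EdgeMinus G r a u v → EdgeMinus G r a u' v' →
                  π⁺ (col χ u v) ≡ π⁺ (col χ u' v') → col χ u v ≡ col χ u' v'
    π-injective e e' = to-injective _ _ (χ-colour e) (χ-colour e')

    centreColour-colour : ∀ w → Edge G r w → w ≢ b → Colour (centreColour w)
    centreColour-colour w erw w≢b with inFan? f t w
    ... | yes (k , k∈ , refl) = κ-colour k (≢b⇒∈[2,t] k∈ w≢b)
    ... | no w∉               = to-range _ (χ-colour (from-centre erw (≢a-off-fan w∉)))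

    proper-at-centre : ∀ v w → Edge G r v → Edge G r w → v ≢ b → w ≢ b → v ≢ w → centreColour v ≢ centreColour w
    proper-at-centre v w erv erw v≢b w≢b v≢w with inFan? f t v | inFan? f t w
    ... | yes (k , k∈ , refl) | yes (k' , k'∈ , refl) =
          λ eq → v≢w (cong f (κ-injective k k' (≢b⇒∈[2,t] k∈ v≢b) (≢b⇒∈[2,t] k'∈ w≢b) eq))
    ... | yes (k , k∈ , refl) | no w∉ = λ eq → κ-free-off-fan w erw w∉ k (≢b⇒∈[2,t] k∈ v≢b) (sym eq)
    ... | no v∉ | yes (k' , k'∈ , refl) = λ eq → κ-free-off-fan v erv v∉ k' (≢b⇒∈[2,t] k'∈ w≢b) eq
    ... | no v∉ | no w∉ = λ eq → col-proper χ r v w ev ew v≢w (π-injective ev ew eq)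
      where
      ev : EdgeMinus G r a r v
      ev = from-centre erv (≢a-off-fan v∉)
      ew : EdgeMinus G r a r w
      ew = from-centre erw (≢a-off-fan w∉)

    proper-beside-centre : ∀ u w → u ≢ r → Edge G r u → u ≢ b → Edge G u w → w ≢ r →
                           centreColour u ≢ π⁺ (col χ u w)
    proper-beside-centre u w u≢r eru u≢b euw w≢r with inFan? f t u
    ... | yes (k , k∈ , refl) = λ eq → κ-free-at-fan k (≢b⇒∈[2,t] k∈ u≢b) w euw w≢r (sym eq)
    ... | no u∉ = λ eq → col-proper χ u r w eur euw' (λ e → w≢r (sym e))
                           (trans (sym (col-sym χ r u er)) (π-injective er euw' eq))
      where
      er : EdgeMinus G r a r u
      er = from-centre eru (≢a-off-fan u∉)
      eur : EdgeMinus G r a u r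
      eur = to-centre eru (≢a-off-fan u∉)
      euw' : EdgeMinus G r a u w
      euw' = off-centre euw u≢r w≢r

    ψ : Col r b
    col ψ = recol
    col-sym ψ u v (e , _) = by-cases (u Fin.≟ r) (v Fin.≟ r)
      where
      by-cases : Dec (u ≡ r) → Dec (v ≡ r) → recol u v ≡ recol v u
      by-cases (yes refl) (yes refl) = refl
      by-cases (yes refl) (no v≢r)   = trans (recol-centre v) (sym (recol-to-centre v v≢r))
      by-cases (no u≢r)   (yes refl) = trans (recol-to-centre u u≢r) (sym (recol-centre u))
      by-cases (no u≢r)   (no v≢r)   =
        trans (recol-off-centre u v u≢r v≢r)
              (trans (cong π⁺ (col-sym χ u v (off-centre e u≢r v≢r))) (sym (recol-off-centre v u v≢r u≢r)))
    col-range ψ u v (e , ns) = by-cases (u Fin.≟ r) (v Fin.≟ r)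
      where
      by-cases : Dec (u ≡ r) → Dec (v ≡ r) → Colour (recol u v)
      by-cases (yes refl) _ = subst Colour (sym (recol-centre v))
                                (centreColour-colour v e (λ v≡b → ns (inj₁ (refl , v≡b))))
      by-cases (no u≢r) (yes refl) = subst Colour (sym (recol-to-centre u u≢r))
                                (centreColour-colour u (edge-sym e) (λ u≡b → ns (inj₂ (u≡b , refl))))
      by-cases (no u≢r) (no v≢r) = subst Colour (sym (recol-off-centre u v u≢r v≢r))
                                (to-range _ (χ-colour (off-centre e u≢r v≢r)))
    col-proper ψ u v w (e₁ , ns₁) (e₂ , ns₂) v≢w = by-cases (u Fin.≟ r) (v Fin.≟ r) (w Fin.≟ r)
      where
      by-cases : Dec (u ≡ r) → Dec (v ≡ r) → Dec (w ≡ r) → recol u v ≢ recol u w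
      by-cases (yes refl) _ _ eq =
        proper-at-centre v w e₁ e₂ (λ e → ns₁ (inj₁ (refl , e))) (λ e → ns₂ (inj₁ (refl , e))) v≢w
          (trans (sym (recol-centre v)) (trans eq (recol-centre w)))
      by-cases (no u≢r) (yes refl) (yes refl) _ = v≢w refl
      by-cases (no u≢r) (yes refl) (no w≢r) eq =
        proper-beside-centre u w u≢r (edge-sym e₁) (λ e → ns₁ (inj₂ (e , refl))) e₂ w≢r
          (trans (sym (recol-to-centre u u≢r)) (trans eq (recol-off-centre u w u≢r w≢r)))
      by-cases (no u≢r) (no v≢r) (yes refl) eq =
        proper-beside-centre u v u≢r (edge-sym e₂) (λ e → ns₂ (inj₂ (e , refl))) e₁ v≢r
          (trans (sym (recol-to-centre u u≢r)) (trans (sym eq) (recol-off-centre u v u≢r v≢r)))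
      by-cases (no u≢r) (no v≢r) (no w≢r) eq =
        col-proper χ u v w ev ew v≢w
          (π-injective ev ew (trans (sym (recol-off-centre u v u≢r v≢r)) (trans eq (recol-off-centre u w u≢r w≢r))))
        where
        ev : EdgeMinus G r a u v
        ev = off-centre e₁ u≢r v≢r
        ew : EdgeMinus G r a u w
        ew = off-centre e₂ u≢r w≢r

    col-fan : ∀ k → InRange 1 t k → col ψ r (f k) ≡ κ k
    col-fan k k∈ = trans (recol-centre (f k)) (centreColour-fan k k∈)

    freeOffCentre-transfer : ∀ x → x ≢ r → ∀ c → Colour c → FreeOffCentre ψ x c ↔ FreeOffCentre χ x (π⁻ c)
    freeOffCentre-transfer x x≢r c rg = to , from
      where
      to : FreeOffCentre ψ x c → FreeOffCentre χ x (π⁻ c)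
      to free u exu u≢r eq = free u exu u≢r (trans (recol-off-centre x u x≢r u≢r) (sym (to-≡ _ c rg (sym eq))))
      from : FreeOffCentre χ x (π⁻ c) → FreeOffCentre ψ x c
      from free u exu u≢r eq = free u exu u≢r
        (sym (from-≡ _ c (χ-colour (off-centre exu x≢r u≢r)) (trans (sym (recol-off-centre x u x≢r u≢r)) eq)))

    missing-at-fan : ∀ k → InRange 1 t k → ∀ c → Colour c →
                  Missing ψ (f k) c ↔ (Colour c × (InRange 2 t k → κ k ≢ c) × FreeOffCentre χ (f k) (π⁻ c))
    missing-at-fan k k∈ c rg = to , from
      where
      erx : Edge G r (f k)
      erx = nbr k k∈
      D = missing-neighbour ψ (f k) c erx
      T = freeOffCentre-transfer (f k) (centre-≢ erx) c rg
      Free : Set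
      Free = Colour c × (InRange 2 t k → κ k ≢ c) × FreeOffCentre χ (f k) (π⁻ c)
      to : Missing ψ (f k) c → Free
      to m with proj₁ D m
      ... | rg' , centre-free , off-free =
            rg' , (λ k∈' eq → centre-free (λ fk≡b → 1∉[2,t] (subst (InRange 2 t) (dist k 1 k∈ (≤-refl , t≥1) (trans fk≡b (sym f1≡b))) k∈'))
                                          (trans (col-fan k k∈) eq))
                , proj₁ T off-free
      from : Free → Missing ψ (f k) c
      from (rg' , centre-free , off-free) =
        proj₂ D (rg' , (λ fk≢b eq → centre-free (≢b⇒∈[2,t] k∈ fk≢b) (trans (sym (col-fan k k∈)) eq)) , proj₂ T off-free)

    missing-at-centre : ∀ c → Colour c →
                      Missing ψ r c ↔ (Colour c × (∀ k → InRange 2 t k → κ k ≢ c) × FreeOffFan f t χ (π⁻ c))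
    missing-at-centre c rg = to , from
      where
      D = missing-centre ψ f t f1≡b t≥1 nbr dist c
      col-off-fan : ∀ u → ¬ InFan f t u → col ψ r u ≡ π⁺ (col χ r u)
      col-off-fan u u∉ = trans (recol-centre u) (centreColour-off-fan u u∉)
      Free : Set
      Free = Colour c × (∀ k → InRange 2 t k → κ k ≢ c) × FreeOffFan f t χ (π⁻ c)
      to : Missing ψ r c → Free
      to m with proj₁ D m
      ... | rg' , fan-free , off-free =
            rg' , (λ k k∈ eq → fan-free k k∈ (trans (col-fan k (∈[2,t]⇒∈[1,t] k∈)) eq))
                , (λ u eru u∉ eq → off-free u eru u∉ (trans (col-off-fan u u∉) (sym (to-≡ _ c rg (sym eq)))))
      from : Free → Missing ψ r c
      from (rg' , fan-free , off-free) =
        proj₂ D (rg' , (λ k k∈ eq → fan-free k k∈ (trans (sym (col-fan k (∈[2,t]⇒∈[1,t] k∈))) eq))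
                     , (λ u eru u∉ eq → off-free u eru u∉
                          (sym (from-≡ _ c (χ-colour (from-centre eru (≢a-off-fan u∉))) (trans (sym (col-off-fan u u∉)) eq)))))

    missing-off-fan : ∀ x → x ≢ r → ¬ InFan f t x → ∀ c → Colour c → Missing ψ x c ↔ Missing χ x (π⁻ c)
    missing-off-fan x x≢r x∉ c rg = to , from
      where
      x≢a : x ≢ a
      x≢a = ≢a-off-fan x∉
      x≢b : x ≢ b
      x≢b refl = x∉ b∈fan
      a→b : ∀ {u} → EdgeMinus G r a x u → EdgeMinus G r b x u
      a→b e = proj₁ e , λ { (inj₁ (x≡r , _)) → x≢r x≡r ; (inj₂ (x≡b , _)) → x≢b x≡b }
      b→a : ∀ {u} → EdgeMinus G r b x u → EdgeMinus G r a x u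
      b→a e = proj₁ e , λ { (inj₁ (x≡r , _)) → x≢r x≡r ; (inj₂ (x≡a , _)) → x≢a x≡a }
      col-x : ∀ u → EdgeMinus G r a x u → col ψ x u ≡ π⁺ (col χ x u)
      col-x u e = by-cases (u Fin.≟ r)
        where
        by-cases : Dec (u ≡ r) → col ψ x u ≡ π⁺ (col χ x u)
        by-cases (no u≢r)   = recol-off-centre x u x≢r u≢r
        by-cases (yes refl) = trans (recol-to-centre x x≢r)
                                (trans (centreColour-off-fan x x∉) (cong π⁺ (col-sym χ r x (from-centre (edge-sym (proj₁ e)) x≢a))))
      to : Missing ψ x c → Missing χ x (π⁻ c)
      to (_ , free) = from-range c rg , λ u e eq → free u (a→b e) (trans (col-x u e) (sym (to-≡ _ c rg (sym eq))))
      from : Missing χ x (π⁻ c) → Missing ψ x c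
      from (_ , free) = rg , λ u e eq → free u (b→a e) (sym (from-≡ _ c (χ-colour (b→a e)) (trans (sym (col-x u (b→a e))) eq)))

  data Position (f : ℕ → Fin n) (t : ℕ) (x : Fin n) : Set where
    is-centre : x ≡ r → Position f t x
    is-first  : f 1 ≡ x → Position f t x
    is-later  : ∀ k → InRange 2 t k → f k ≡ x → Position f t x

  position : ∀ {f t x} → InV r t f x → Position f t x
  position (inj₁ x≡r) = is-centre x≡r
  position (inj₂ (k , k∈ , fk≡x)) with k ≟ 1
  ... | yes refl = is-first fk≡x
  ... | no k≢1   = is-later k (≢1⇒∈[2,t] k∈ k≢1) fk≡x

  MissingAt : ∀ {f t x} → Position f t x → ℕ → Set
  MissingAt (is-centre _)    c = c ≡ 1
  MissingAt (is-first _)     c = c ≡ 2 ⊎ c ≡ Δ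
  MissingAt (is-later k _ _) c = c ≡ suc k

  FanMissing : ℕ → ℕ → Set
  FanMissing t c = c ≡ 1 ⊎ c ≡ Δ ⊎ InRange 2 (suc t) c

  module Typical2Inducing {b : Fin n} {ψ : Col r b} {t : ℕ} {f : ℕ → Fin n}
                          (typical : Typical r b ψ t f t) (t<Δ : suc t < Δ) where

    missingAt : ∀ {x c} (pos : Position f t x) → Missing ψ x c → MissingAt pos c
    missingAt (is-centre refl)     m = proj₁ (proj₁ (proj₂ typical) _) m
    missingAt (is-first refl)      m = proj₁ (proj₁ (proj₂ (proj₂ typical)) _) m
    missingAt (is-later k k∈ refl) m = proj₁ (proj₂ (proj₁ (proj₂ (proj₂ (proj₂ typical))) k k∈ (<⇒≢ (s≤s (proj₂ k∈)))) _) m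

    fanMissing : ∀ {x c} (pos : Position f t x) → MissingAt pos c → FanMissing t c
    fanMissing (is-centre _)         c≡1          = inj₁ c≡1
    fanMissing (is-first _)          (inj₁ refl)  = inj₂ (inj₂ (≤-refl , s≤s (proj₁ (proj₁ typical))))
    fanMissing (is-first _)          (inj₂ c≡Δ)   = inj₂ (inj₁ c≡Δ)
    fanMissing (is-later k (p , q) _) refl        = inj₂ (inj₂ (≤-trans (n≤1+n 2) (s≤s p) , s≤s q))

    private
      1∉firstPair : ∀ {c} → c ≡ 1 → c ≡ 2 ⊎ c ≡ Δ → ⊥
      1∉firstPair refl (inj₁ ())
      1∉firstPair refl (inj₂ 1≡Δ) = <-irrefl 1≡Δ (≤-trans (s≤s (s≤s z≤n)) t<Δ)

      1≢later : ∀ {k} → InRange 2 t k → 1 ≢ suc k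
      1≢later (() , _) refl

      firstPair∌later : ∀ {c k} → c ≡ 2 ⊎ c ≡ Δ → InRange 2 t k → c ≡ suc k → ⊥
      firstPair∌later (inj₁ refl) (s≤s () , _) refl
      firstPair∌later (inj₂ refl) (_ , k≤t) Δ≡1+k = <-irrefl (sym Δ≡1+k) (≤-trans (s≤s (s≤s k≤t)) t<Δ)

      clash : ∀ {x y c} (px : Position f t x) (py : Position f t y) → x ≢ y → MissingAt px c → MissingAt py c → ⊥
      clash (is-centre x≡r)    (is-centre y≡r)     x≢y _  _  = x≢y (trans x≡r (sym y≡r))
      clash (is-centre _)      (is-first _)        _   cx cy = 1∉firstPair cx cy
      clash (is-centre _)      (is-later k k∈ _)   _   refl cy = 1≢later k∈ cy
      clash (is-first _)       (is-centre _)       _   cx cy = 1∉firstPair cy cx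
      clash (is-first f1≡x)    (is-first f1≡y)     x≢y _  _  = x≢y (trans (sym f1≡x) f1≡y)
      clash (is-first _)       (is-later k k∈ _)   _   cx cy = firstPair∌later cx k∈ cy
      clash (is-later k k∈ _)  (is-centre _)       _   cx refl = 1≢later k∈ cx
      clash (is-later k k∈ _)  (is-first _)        _   cx cy = firstPair∌later cy k∈ cx
      clash (is-later k _ fk≡x) (is-later k' _ fk'≡y) x≢y cx cy =
        x≢y (trans (sym fk≡x) (trans (cong f (suc-injective (trans (sym cx) cy))) fk'≡y))

    elementary : Elementary ψ (InV r t f)
    elementary x y x∈ y∈ x≢y c mx my = clash (position x∈) (position y∈) x≢y (missingAt _ mx) (missingAt _ my)

-- Rotating a typical pseudo-multifan

record TypicalColouring {n : ℕ} (G : Graph n) (Δ : ℕ) {r s₁ : Fin n} (φ : HZ.Col G Δ r s₁)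
                        (t : ℕ) (s : ℕ → Fin n) (a : ℕ) : Set where
  field
    missing-r  : ∀ c → Missing φ r c ↔ c ≡ 1
    missing-s₁ : ∀ c → Missing φ (s 1) c ↔ (c ≡ 2 ⊎ c ≡ Δ)
    missing-s  : ∀ i → InRange 2 t i → ∀ c → Missing φ (s i) c ↔ c ≡ suc i
    colour-rs  : ∀ i → InRange 2 t i → col φ r (s i) ≡ fanColour Δ a i

module RotatedPseudoMultifan {n : ℕ} (G : Graph n) (Δ : ℕ) {r s₁ : Fin n} {φ : HZ.Col G Δ r s₁} {t p a : ℕ} {s : ℕ → Fin n}
                (PM : HZ.IsPseudoMultifan G Δ r s₁ φ t p s) (TC : TypicalColouring G Δ φ t s a)
                (t<Δ : suc t < Δ) (R : Rotation Δ t a) where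

  open HZ G Δ
  open Centred G Δ r
  open IsPseudoMultifan PM
  open TypicalColouring TC
  open Rotation R
  open Permutation colour using (to-range; from-range; from-to; from-≡; to-≡) renaming (from to π⁻¹)

  t≥1 : 1 ≤ t
  t≥1 = IsMultifan.p≥1 (proj₁ maximum)

  1∈[1,t] : InRange 1 t 1
  1∈[1,t] = ≤-refl , t≥1

  t∈[1,t] : InRange 1 t t
  t∈[1,t] = t≥1 , ≤-refl

  ∈[1,p] : ∀ {k} → InRange 1 t k → InRange 1 p k
  ∈[1,p] (k≥1 , k≤t) = k≥1 , ≤-trans k≤t t≤p

  σ⁺ : Permutation p
  σ⁺ = widen t≤p fan fan-fixed fan⁻¹-fixed

  open Permutation fan using () renaming (from to σ⁻¹; to-range to σ-range; from-range to σ⁻¹-range;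
                                   from-to to σ⁻¹∘σ; to-from to σ∘σ⁻¹)

  s* : ℕ → Fin n
  s* k = s (σ k)

  nbr : Neighbours s t
  nbr k k∈ = adjacent k (∈[1,p] k∈)

  dist : Distinct s t
  dist i j i∈ j∈ = distinct i j (∈[1,p] i∈) (∈[1,p] j∈)

  nbr* : ∀ k → InRange 1 p k → Edge G r (s* k)
  nbr* k k∈ = adjacent (σ k) (Permutation.to-range σ⁺ k k∈)

  dist* : ∀ i j → InRange 1 p i → InRange 1 p j → s* i ≡ s* j → i ≡ j
  dist* i j i∈ j∈ e =
    Permutation.to-injective σ⁺ i j i∈ j∈ (distinct (σ i) (σ j) (Permutation.to-range σ⁺ i i∈) (Permutation.to-range σ⁺ j j∈) e)

  nbrᵗ* : Neighbours s* t
  nbrᵗ* k k∈ = nbr* k (∈[1,p] k∈)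

  distᵗ* : Distinct s* t
  distᵗ* i j i∈ j∈ = dist* i j (∈[1,p] i∈) (∈[1,p] j∈)

  inFan→* : ∀ {x} → InFan s t x → InFan s* t x
  inFan→* (i , i∈ , e) = σ⁻¹ i , σ⁻¹-range i i∈ , trans (cong s (σ∘σ⁻¹ i i∈)) e

  inFan←* : ∀ {x} → InFan s* t x → InFan s t x
  inFan←* (k , k∈ , e) = σ k , σ-range k k∈ , e

  sameVertices : ∀ x → InV r p s x ↔ InV r p s* x
  sameVertices x = to , from
    where
    to : InV r p s x → InV r p s* x
    to (inj₁ e) = inj₁ e
    to (inj₂ (i , i∈ , e)) = inj₂ (Permutation.from σ⁺ i , Permutation.from-range σ⁺ i i∈ , trans (cong s (Permutation.to-from σ⁺ i i∈)) e)
    from : InV r p s* x → InV r p s x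
    from (inj₁ e) = inj₁ e
    from (inj₂ (k , k∈ , e)) = inj₂ (σ k , Permutation.to-range σ⁺ k k∈ , e)

  freeOffFan→* : ∀ {u v} (ψ : Col u v) d → FreeOffFan s t ψ d → FreeOffFan s* t ψ d
  freeOffFan→* ψ d free u e u∉ = free u e (λ u∈ → u∉ (inFan→* u∈))

  freeOffFan←* : ∀ {u v} (ψ : Col u v) d → FreeOffFan s* t ψ d → FreeOffFan s t ψ d
  freeOffFan←* ψ d free u e u∉ = free u e (λ u∈ → u∉ (inFan←* u∈))

  si≢s₁ : ∀ {i} → InRange 2 t i → s i ≢ s₁
  si≢s₁ {i} i∈ e = 1∉[2,t] (subst (InRange 2 t) (dist i 1 (∈[2,t]⇒∈[1,t] i∈) 1∈[1,t] (trans e (sym first))) i∈)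

  r-s : ∀ {i} → InRange 2 t i → EdgeMinus G r s₁ r (s i)
  r-s i∈ = from-centre (nbr _ (∈[2,t]⇒∈[1,t] i∈)) (si≢s₁ i∈)

  E-colour : ∀ i → InRange 1 t i → Colour (E i)
  E-colour i i∈ with fanColour-cases Δ a i
  ... | inj₁ e = subst Colour (sym e) (≤-trans (s≤s z≤n) t<Δ , ≤-refl)
  ... | inj₂ e = subst Colour (sym e) (proj₁ i∈ , ≤-trans (proj₂ i∈) (≤-trans (n≤1+n t) (<⇒≤ t<Δ)))

  suc-colour : ∀ i → InRange 1 t i → Colour (suc i)
  suc-colour i (_ , i≤t) = s≤s z≤n , ≤-trans (s≤s i≤t) (<⇒≤ t<Δ)

  fan-colour : ∀ k → InRange 2 t k → Colour k
  fan-colour k k∈ = proj₁ (∈[2,t]⇒∈[1,t] k∈) , ≤-trans (proj₂ k∈) (≤-trans (n≤1+n t) (<⇒≤ t<Δ))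

  freePair : ∀ i → InRange 1 t i → ∀ d → Colour d → FreeOffCentre φ (s i) d ↔ (d ≡ suc i ⊎ d ≡ E i)
  freePair zero (() , _)
  freePair (suc zero) i∈ d rg = (λ free → cases (proj₁ D free)) , λ e → proj₂ D (inj₁ (proj₂ (missing-s₁ d) e))
    where
    D = freeOffCentre⇔ φ (s 1) d (nbr 1 i∈) rg
    cases : Missing φ (s 1) d ⊎ (s 1 ≢ s₁ × col φ r (s 1) ≡ d) → d ≡ 2 ⊎ d ≡ Δ
    cases (inj₁ m) = proj₁ (missing-s₁ d) m
    cases (inj₂ (ne , _)) = ⊥-elim (ne first)
  freePair i@(suc (suc _)) i∈ d rg = (λ free → cases (proj₁ D free)) , back
    where
    i∈' : InRange 2 t i
    i∈' = s≤s (s≤s z≤n) , proj₂ i∈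
    D = freeOffCentre⇔ φ (s i) d (nbr i i∈) rg
    cases : Missing φ (s i) d ⊎ (s i ≢ s₁ × col φ r (s i) ≡ d) → d ≡ suc i ⊎ d ≡ E i
    cases (inj₁ m) = inj₁ (proj₁ (missing-s i i∈' d) m)
    cases (inj₂ (_ , e)) = inj₂ (trans (sym e) (colour-rs i i∈'))
    back : d ≡ suc i ⊎ d ≡ E i → FreeOffCentre φ (s i) d
    back (inj₁ e) = proj₂ D (inj₁ (proj₂ (missing-s i i∈' d) e))
    back (inj₂ e) = proj₂ D (inj₂ (si≢s₁ i∈' , trans (colour-rs i i∈') (sym e)))

  π⁻¹-first : π⁻¹ 1 ≡ 1
  π⁻¹-first = from-≡ 1 1 (≤-refl , ≤-trans (s≤s z≤n) (<⇒≤ t<Δ)) colour-first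

  π⁻¹-freePair : ∀ k → InRange 2 t k → π⁻¹ k ≡ suc (σ k) ⊎ π⁻¹ k ≡ E (σ k)
  π⁻¹-freePair k k∈ with colour-pair k k∈
  ... | inj₁ (e , _) = inj₁ (from-≡ _ k (suc-colour _ (σ-range k (∈[2,t]⇒∈[1,t] k∈))) e)
  ... | inj₂ (_ , e) = inj₂ (from-≡ _ k (E-colour _ (σ-range k (∈[2,t]⇒∈[1,t] k∈))) e)

  freeOffFan⇒ : ∀ d → Colour d → FreeOffFan s t φ d → d ≡ 1 ⊎ ∃ λ j → InRange 2 t j × E j ≡ d
  freeOffFan⇒ d rg free with anyInRange? (λ j → E j ≟ d) 2 t
  ... | yes used = inj₂ used
  ... | no unused = inj₁ (proj₁ (missing-r d) (proj₂ (missing-centre φ s t first t≥1 nbr dist d)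
                      (rg , (λ k k∈ e → unused (k , k∈ , trans (sym (colour-rs k k∈)) e)) , free)))

  s*1≡st : s* 1 ≡ s t
  s*1≡st = cong s fan-first

  s₁∈fan* : InFan s* t s₁
  s₁∈fan* = inFan→* (1 , 1∈[1,t] , first)

  fanColours-free-off-fan : ∀ u → Edge G r u → ¬ InFan s* t u → ∀ k → InRange 2 t k → π (col φ r u) ≢ k
  fanColours-free-off-fan u eru u∉ k k∈ eq =
    clash (fanColour-onto (col φ r u) (col-range φ r u r-u) (subst (InRange 2 t) (sym eq) k∈))
    where
    r-u : EdgeMinus G r s₁ r u
    r-u = from-centre eru (λ { refl → u∉ s₁∈fan* })
    clash : (∃ λ j → InRange 2 t j × E j ≡ col φ r u) → ⊥
    clash (j , j∈ , Ej≡) = col-proper φ r (s j) u (r-s j∈) r-u (λ e → u∉ (inFan→* (j , ∈[2,t]⇒∈[1,t] j∈ , e)))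
                             (trans (colour-rs j j∈) Ej≡)

  fanColours-free-at-fan : ∀ k → InRange 2 t k → ∀ u → Edge G (s* k) u → u ≢ r → π (col φ (s* k) u) ≢ k
  fanColours-free-at-fan k k∈ u e u≢r eq =
    free u e u≢r (sym (from-≡ _ k (col-range φ (s* k) u (off-centre e (centre-≢ (nbrᵗ* k (∈[2,t]⇒∈[1,t] k∈))) u≢r)) eq))
    where
    free : FreeOffCentre φ (s* k) (π⁻¹ k)
    free = proj₂ (freePair (σ k) (σ-range k (∈[2,t]⇒∈[1,t] k∈)) (π⁻¹ k) (from-range k (fan-colour k k∈)))
                 (π⁻¹-freePair k k∈)

  module Forward = Centred.FanRecolouring G Δ r φ s* t s*1≡st t≥1 nbrᵗ* distᵗ* s₁∈fan* colour (λ k → k)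
                     fan-colour (λ _ _ _ _ e → e) fanColours-free-off-fan fanColours-free-at-fan

  φ′ : Col r (s t)
  φ′ = Forward.ψ

  missing′-fan : ∀ k → InRange 1 t k → ∀ c → Colour c →
                 Missing φ′ (s* k) c ↔ (Colour c × (InRange 2 t k → k ≢ c) × (π⁻¹ c ≡ suc (σ k) ⊎ π⁻¹ c ≡ E (σ k)))
  missing′-fan k k∈ c rg = (λ m → map₂ (map₂ (proj₁ P)) (proj₁ M m)) , (λ q → proj₂ M (map₂ (map₂ (proj₂ P)) q))
    where
    M = Forward.missing-at-fan k k∈ c rg
    P = freePair (σ k) (σ-range k k∈) (π⁻¹ c) (from-range c rg)

  missing′-r : ∀ c → Missing φ′ r c ↔ c ≡ 1
  missing′-r c = to , from
    where
    colour-1 : Colour 1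
    colour-1 = ≤-refl , ≤-trans (s≤s z≤n) (<⇒≤ t<Δ)
    to : Missing φ′ r c → c ≡ 1
    to m with proj₁ (Forward.missing-at-centre c (proj₁ m)) m
    ... | rg , fan-free , off-free with freeOffFan⇒ (π⁻¹ c) (from-range c rg) (freeOffFan←* φ (π⁻¹ c) off-free)
    ... | inj₁ e = trans (to-≡ 1 c rg e) colour-first
    ... | inj₂ (j , j∈ , Ej≡) = ⊥-elim (fan-free (π (E j)) (fanColour-into j j∈) (sym (to-≡ (E j) c rg (sym Ej≡))))
    from : c ≡ 1 → Missing φ′ r c
    from refl = proj₂ (Forward.missing-at-centre 1 colour-1)
                  (colour-1 , (λ { k (k≥2 , _) refl → <⇒≱ k≥2 (s≤s z≤n) })
                  , subst (FreeOffFan s* t φ) (sym π⁻¹-first)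
                      (freeOffFan→* φ 1 (proj₂ (proj₂ (proj₁ (missing-centre φ s t first t≥1 nbr dist 1)
                                                              (proj₂ (missing-r 1) refl))))))

  missing′-s*1 : ∀ c → Missing φ′ (s* 1) c ↔ (c ≡ 2 ⊎ c ≡ Δ)
  missing′-s*1 c = to , from
    where
    to : Missing φ′ (s* 1) c → c ≡ 2 ⊎ c ≡ Δ
    to m with proj₁ (missing′-fan 1 1∈[1,t] c (proj₁ m)) m
    ... | rg , _ , q with subst (λ i → π⁻¹ c ≡ suc i ⊎ π⁻¹ c ≡ E i) fan-first q
    ... | inj₁ e = inj₂ (trans (to-≡ _ c rg e) (proj₁ colour-last))
    ... | inj₂ e = inj₁ (trans (to-≡ _ c rg e) (proj₂ colour-last))
    from : c ≡ 2 ⊎ c ≡ Δ → Missing φ′ (s* 1) c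
    from q = proj₂ (missing′-fan 1 1∈[1,t] c rg)
               (rg , (λ 1∈ → ⊥-elim (1∉[2,t] 1∈)) , subst (λ i → π⁻¹ c ≡ suc i ⊎ π⁻¹ c ≡ E i) (sym fan-first) (pair q))
      where
      colour-2orΔ : ∀ {d} → d ≡ 2 ⊎ d ≡ Δ → Colour d
      colour-2orΔ (inj₁ refl) = s≤s z≤n , ≤-trans (s≤s (s≤s z≤n)) (≤-trans (s≤s (s≤s t≥1)) t<Δ)
      colour-2orΔ (inj₂ refl) = ≤-trans (s≤s z≤n) t<Δ , ≤-refl
      rg : Colour c
      rg = colour-2orΔ q
      pair : c ≡ 2 ⊎ c ≡ Δ → π⁻¹ c ≡ suc t ⊎ π⁻¹ c ≡ E t
      pair (inj₁ refl) = inj₂ (from-≡ _ 2 (E-colour t t∈[1,t]) (proj₂ colour-last))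
      pair (inj₂ refl) = inj₁ (from-≡ _ Δ (suc-colour t t∈[1,t]) (proj₁ colour-last))

  missing′-s* : ∀ k → InRange 2 t k → ∀ c → Missing φ′ (s* k) c ↔ c ≡ suc k
  missing′-s* k k∈ c = to , from
    where
    k∈' : InRange 1 t k
    k∈' = ∈[2,t]⇒∈[1,t] k∈
    σk∈ : InRange 1 t (σ k)
    σk∈ = σ-range k k∈'
    to : Missing φ′ (s* k) c → c ≡ suc k
    to m with proj₁ (missing′-fan k k∈' c (proj₁ m)) m
    ... | rg , k≢c , q with q | colour-pair k k∈
    ... | inj₁ e | inj₁ (πs≡k , _)   = ⊥-elim (k≢c k∈ (sym (trans (to-≡ _ c rg e) πs≡k)))
    ... | inj₁ e | inj₂ (πs≡1+k , _) = trans (to-≡ _ c rg e) πs≡1+k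
    ... | inj₂ e | inj₁ (_ , πE≡1+k) = trans (to-≡ _ c rg e) πE≡1+k
    ... | inj₂ e | inj₂ (_ , πE≡k)   = ⊥-elim (k≢c k∈ (sym (trans (to-≡ _ c rg e) πE≡k)))
    from : c ≡ suc k → Missing φ′ (s* k) c
    from refl = proj₂ (missing′-fan k k∈' (suc k) (suc-colour k k∈'))
                  (suc-colour k k∈' , (λ _ → <⇒≢ (n<1+n k)) , pair (colour-pair k k∈))
      where
      pair : MapsPairTo π (suc (σ k)) (E (σ k)) k (suc k) → π⁻¹ (suc k) ≡ suc (σ k) ⊎ π⁻¹ (suc k) ≡ E (σ k)
      pair (inj₁ (_ , πE≡1+k)) = inj₂ (from-≡ _ _ (E-colour _ σk∈) πE≡1+k)
      pair (inj₂ (πs≡1+k , _)) = inj₁ (from-≡ _ _ (suc-colour _ σk∈) πs≡1+k)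

  typical′ : Typical r (s t) φ′ t s* t
  typical′ = t∈[1,t] , missing′-r , missing′-s*1
           , (λ i i∈ _ → Forward.col-fan i (∈[2,t]⇒∈[1,t] i∈) , missing′-s* i i∈)
           , (λ t<t → ⊥-elim (<-irrefl refl t<t))

  multifan′ : IsMultifan r (s t) φ′ t s*
  multifan′ = record
    { p≥1 = t≥1 ; first = s*1≡st ; adjacent = nbrᵗ* ; distinct = distᵗ*
    ; degs = λ k k∈ → IsMultifan.degs (proj₁ maximum) (σ k) (σ-range k k∈)
    ; chain = chain }
    where
    chain : ∀ i → InRange 2 t i → ∃ λ j → InRange 1 (i ∸ 1) j × Missing φ′ (s* j) (col φ′ r (s* i))
    chain (suc zero) (s≤s () , _)
    chain (suc (suc zero)) i∈ = 1 , (≤-refl , ≤-refl) ,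
      subst (Missing φ′ (s* 1)) (sym (Forward.col-fan 2 (∈[2,t]⇒∈[1,t] i∈))) (proj₂ (missing′-s*1 2) (inj₁ refl))
    chain (suc (suc (suc j))) i∈ = suc (suc j) , (s≤s z≤n , ≤-refl) ,
      subst (Missing φ′ (s* (suc (suc j)))) (sym (Forward.col-fan _ (∈[2,t]⇒∈[1,t] i∈)))
        (proj₂ (missing′-s* (suc (suc j)) (s≤s (s≤s z≤n) , ≤-trans (n≤1+n _) (proj₂ i∈)) _) refl)

  E-injective : ∀ j j' → InRange 2 t j → InRange 2 t j' → E j ≡ E j' → j ≡ j'
  E-injective j j' j∈ j'∈ e with j ≟ j'
  ... | yes j≡j' = j≡j'
  ... | no j≢j'  = ⊥-elim (col-proper φ r (s j) (s j') (r-s j∈) (r-s j'∈)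
                             (λ e' → j≢j' (dist j j' (∈[2,t]⇒∈[1,t] j∈) (∈[2,t]⇒∈[1,t] j'∈) e'))
                             (trans (colour-rs j j∈) (trans e (sym (colour-rs j' j'∈)))))

  module Backward (φ″ : Col r (s t)) (stable : Stable r (s t) φ′ t s* φ″) where

    col″-fan : ∀ k → InRange 2 t k → col φ″ r (s* k) ≡ k
    col″-fan k k∈ = trans (proj₂ stable k k∈) (Forward.col-fan k (∈[2,t]⇒∈[1,t] k∈))

    s*k≢st : ∀ {k} → InRange 2 t k → s* k ≢ s t
    s*k≢st {k} k∈ e = 1∉[2,t] (subst (InRange 2 t) (distᵗ* k 1 (∈[2,t]⇒∈[1,t] k∈) 1∈[1,t] (trans e (sym s*1≡st))) k∈)

    st∈fan : InFan s t (s t)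
    st∈fan = t , t∈[1,t] , refl

    fanColours-free-off-fan″ : ∀ u → Edge G r u → ¬ InFan s t u → ∀ j → InRange 2 t j → π⁻¹ (col φ″ r u) ≢ E j
    fanColours-free-off-fan″ u eru u∉ j j∈ eq =
      col-proper φ″ r (s* k) u r-s*k r-u (λ e → u∉ (inFan←* (k , ∈[2,t]⇒∈[1,t] k∈ , e)))
        (trans (col″-fan k k∈) (sym (to-≡ (E j) _ (col-range φ″ r u r-u) eq)))
      where
      k : ℕ
      k = π (E j)
      k∈ : InRange 2 t k
      k∈ = fanColour-into j j∈
      r-u : EdgeMinus G r (s t) r u
      r-u = from-centre eru (λ { refl → u∉ st∈fan })
      r-s*k : EdgeMinus G r (s t) r (s* k)
      r-s*k = from-centre (nbrᵗ* k (∈[2,t]⇒∈[1,t] k∈)) (s*k≢st k∈)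

    freeOffCentre″ : ∀ k → InRange 1 t k → ∀ c → Colour c → FreeOffCentre φ″ (s* k) c ↔ FreeOffCentre φ′ (s* k) c
    freeOffCentre″ k k∈ c rg = (λ free → proj₂ D′ (to (proj₁ D″ free))) , (λ free → proj₂ D″ (from (proj₁ D′ free)))
      where
      D″ = freeOffCentre⇔ φ″ (s* k) c (nbrᵗ* k k∈) rg
      D′ = freeOffCentre⇔ φ′ (s* k) c (nbrᵗ* k k∈) rg
      M = proj₁ stable (s* k) (inj₂ (k , k∈ , refl)) c
      k∈' : s* k ≢ s t → InRange 2 t k
      k∈' ne = ≢1⇒∈[2,t] k∈ λ { refl → ne s*1≡st }
      Free : Col r (s t) → Set
      Free χ = Missing χ (s* k) c ⊎ (s* k ≢ s t × col χ r (s* k) ≡ c)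
      to : Free φ″ → Free φ′
      to (inj₁ m) = inj₁ (proj₁ M m)
      to (inj₂ (ne , e)) = inj₂ (ne , trans (sym (proj₂ stable k (k∈' ne))) e)
      from : Free φ′ → Free φ″
      from (inj₁ m) = inj₁ (proj₂ M m)
      from (inj₂ (ne , e)) = inj₂ (ne , trans (proj₂ stable k (k∈' ne)) e)

    freeOffCentre-s : ∀ i → InRange 1 t i → ∀ c → Colour c → FreeOffCentre φ″ (s i) (π c) ↔ FreeOffCentre φ (s i) c
    freeOffCentre-s i i∈ c rg = subst (λ y → FreeOffCentre φ″ y (π c) ↔ FreeOffCentre φ y c) (cong s (σ∘σ⁻¹ i i∈)) (to , from)
      where
      k : ℕ
      k = σ⁻¹ i
      k∈ : InRange 1 t k
      k∈ = σ⁻¹-range i i∈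
      T = Forward.freeOffCentre-transfer (s* k) (centre-≢ (nbrᵗ* k k∈)) (π c) (to-range c rg)
      F = freeOffCentre″ k k∈ (π c) (to-range c rg)
      to : FreeOffCentre φ″ (s* k) (π c) → FreeOffCentre φ (s* k) c
      to free = subst (FreeOffCentre φ (s* k)) (from-to c rg) (proj₁ T (proj₁ F free))
      from : FreeOffCentre φ (s* k) c → FreeOffCentre φ″ (s* k) (π c)
      from free = proj₂ F (proj₂ T (subst (FreeOffCentre φ (s* k)) (sym (from-to c rg)) free))

    fanColours-free-at-fan″ : ∀ j → InRange 2 t j → ∀ u → Edge G (s j) u → u ≢ r → π⁻¹ (col φ″ (s j) u) ≢ E j
    fanColours-free-at-fan″ j j∈ u e u≢r eq =
      free u e u≢r (to-≡ (E j) _ (col-range φ″ (s j) u (off-centre e (centre-≢ (nbr j j∈')) u≢r)) eq)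
      where
      j∈' : InRange 1 t j
      j∈' = ∈[2,t]⇒∈[1,t] j∈
      free : FreeOffCentre φ″ (s j) (π (E j))
      free = proj₂ (freeOffCentre-s j j∈' (E j) (E-colour j j∈'))
                   (proj₂ (freePair j j∈' (E j) (E-colour j j∈')) (inj₂ refl))

    module Recoloured = Centred.FanRecolouring G Δ r φ″ s t first t≥1 nbr dist st∈fan (inverse colour) E
                          (λ j j∈ → E-colour j (∈[2,t]⇒∈[1,t] j∈)) E-injective fanColours-free-off-fan″ fanColours-free-at-fan″

    ψ : Col r s₁
    ψ = Recoloured.ψ

    π-avoids-fan : ∀ c → Colour c → (∀ j → InRange 2 t j → E j ≢ c) → ∀ k → InRange 2 t k → k ≢ π c
    π-avoids-fan c rg unused k k∈ k≡πc with fanColour-onto c rg (subst (InRange 2 t) k≡πc k∈)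
    ... | j , j∈ , Ej≡c = unused j j∈ Ej≡c

    freeOffFan″ : ∀ c → Colour c → (∀ j → InRange 2 t j → E j ≢ c) →
                  FreeOffFan s t φ″ (π c) ↔ FreeOffFan s t φ c
    freeOffFan″ c rg unused = to , from
      where
      D″ = missing-centre φ″ s* t s*1≡st t≥1 nbrᵗ* distᵗ* (π c)
      D′ = Forward.missing-at-centre (π c) (to-range c rg)
      S = proj₁ stable r (inj₁ refl) (π c)
      to : FreeOffFan s t φ″ (π c) → FreeOffFan s t φ c
      to free = subst (FreeOffFan s t φ) (from-to c rg)
        (freeOffFan←* φ _ (proj₂ (proj₂ (proj₁ D′ (proj₁ S (proj₂ D″
          (to-range c rg , (λ k k∈ e → π-avoids-fan c rg unused k k∈ (trans (sym (col″-fan k k∈)) e))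
          , freeOffFan→* φ″ _ free)))))))
      from : FreeOffFan s t φ c → FreeOffFan s t φ″ (π c)
      from free = freeOffFan←* φ″ _ (proj₂ (proj₂ (proj₁ D″ (proj₂ S (proj₂ D′
        (to-range c rg , π-avoids-fan c rg unused
        , freeOffFan→* φ _ (subst (FreeOffFan s t φ) (sym (from-to c rg)) free)))))))

    stable-r : ∀ c → Missing ψ r c ↔ Missing φ r c
    stable-r c = (λ m → to (proj₁ m) m) , (λ m → from (proj₁ m) m)
      where
      D = missing-centre φ s t first t≥1 nbr dist c
      to : Colour c → Missing ψ r c → Missing φ r c
      to rg m with proj₁ (Recoloured.missing-at-centre c rg) m
      ... | rg' , unused , free = proj₂ D (rg' , (λ k k∈ e → unused k k∈ (trans (sym (colour-rs k k∈)) e))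
                                               , proj₁ (freeOffFan″ c rg unused) free)
      from : Colour c → Missing φ r c → Missing ψ r c
      from rg m with proj₁ D m
      ... | rg' , unused , free = proj₂ (Recoloured.missing-at-centre c rg)
                                    (rg' , unused′ , proj₂ (freeOffFan″ c rg unused′) free)
        where
        unused′ : ∀ k → InRange 2 t k → E k ≢ c
        unused′ k k∈ e = unused k k∈ (trans (colour-rs k k∈) e)

    stable-s : ∀ i → InRange 1 t i → ∀ c → Missing ψ (s i) c ↔ Missing φ (s i) c
    stable-s i i∈ c = (λ m → to (proj₁ m) m) , (λ m → from (proj₁ m) m)
      where
      D = missing-neighbour φ (s i) c (nbr i i∈)
      to : Colour c → Missing ψ (s i) c → Missing φ (s i) c
      to rg m with proj₁ (Recoloured.missing-at-fan i i∈ c rg) m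
      ... | rg' , unused , free =
            proj₂ D (rg' , (λ ne e → unused (i∈' ne) (trans (sym (colour-rs i (i∈' ne))) e))
                         , proj₁ (freeOffCentre-s i i∈ c rg) free)
        where
        i∈' : s i ≢ s₁ → InRange 2 t i
        i∈' ne = ≢1⇒∈[2,t] i∈ λ { refl → ne first }
      from : Colour c → Missing φ (s i) c → Missing ψ (s i) c
      from rg m with proj₁ D m
      ... | rg' , unused , free =
            proj₂ (Recoloured.missing-at-fan i i∈ c rg)
              (rg' , (λ i∈' e → unused (si≢s₁ i∈') (trans (colour-rs i i∈') e)) , proj₂ (freeOffCentre-s i i∈ c rg) free)

    stable-ψ : Stable r s₁ φ t s ψ
    stable-ψ = (λ { x (inj₁ refl) c → stable-r c ; x (inj₂ (i , i∈ , refl)) c → stable-s i i∈ c })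
             , (λ i i∈ → trans (Recoloured.col-fan i (∈[2,t]⇒∈[1,t] i∈)) (sym (colour-rs i i∈)))

    elementary-ψ : Elementary ψ (InV r p s)
    elementary-ψ = elementary ψ stable-ψ

  E-fanMissing : ∀ i → InRange 1 t i → FanMissing t (E i)
  E-fanMissing i (i≥1 , i≤t) with fanColour-cases Δ a i
  ... | inj₁ Ei≡Δ = inj₂ (inj₁ Ei≡Δ)
  ... | inj₂ Ei≡i with i ≟ 1
  ...   | yes i≡1 = inj₁ (trans Ei≡i i≡1)
  ...   | no i≢1  = inj₂ (inj₂ (subst (InRange 2 (suc t)) (sym Ei≡i) (≤∧≢⇒< i≥1 (λ e → i≢1 (sym e)) , ≤-trans i≤t (n≤1+n t))))

  suc-fanMissing : ∀ i → InRange 1 t i → FanMissing t (suc i)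
  suc-fanMissing i (i≥1 , i≤t) = inj₂ (inj₂ (s≤s i≥1 , s≤s i≤t))

  π⁻¹-fanMissing : ∀ c → FanMissing t c → FanMissing t (π⁻¹ c)
  π⁻¹-fanMissing c (inj₁ refl) = inj₁ π⁻¹-first
  π⁻¹-fanMissing c (inj₂ (inj₁ refl)) =
    subst (FanMissing t) (sym (from-≡ _ Δ (suc-colour t t∈[1,t]) (proj₁ colour-last))) (suc-fanMissing t t∈[1,t])
  π⁻¹-fanMissing (suc zero) (inj₂ (inj₂ (s≤s () , _)))
  π⁻¹-fanMissing (suc (suc zero)) (inj₂ (inj₂ _)) =
    subst (FanMissing t) (sym (from-≡ _ 2 (E-colour t t∈[1,t]) (proj₂ colour-last))) (E-fanMissing t t∈[1,t])
  π⁻¹-fanMissing (suc k@(suc (suc _))) (inj₂ (inj₂ (_ , s≤s k≤t))) with colour-pair k (s≤s (s≤s z≤n) , k≤t)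
  ... | inj₁ (_ , πE≡1+k) = subst (FanMissing t) (sym (from-≡ _ _ (E-colour _ σk∈) πE≡1+k)) (E-fanMissing _ σk∈)
    where σk∈ = σ-range k (s≤s z≤n , k≤t)
  ... | inj₂ (πs≡1+k , _) = subst (FanMissing t) (sym (from-≡ _ _ (suc-colour _ σk∈) πs≡1+k)) (suc-fanMissing _ σk∈)
    where σk∈ = σ-range k (s≤s z≤n , k≤t)

  fanMissing-witness : ∀ c → FanMissing t c → ∃ λ z → InV r t s z × Missing φ z c
  fanMissing-witness c (inj₁ refl) = r , inj₁ refl , proj₂ (missing-r 1) refl
  fanMissing-witness c (inj₂ (inj₁ refl)) = s 1 , inj₂ (1 , 1∈[1,t] , refl) , proj₂ (missing-s₁ Δ) (inj₂ refl)
  fanMissing-witness (suc zero) (inj₂ (inj₂ (s≤s () , _)))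
  fanMissing-witness (suc (suc zero)) (inj₂ (inj₂ _)) = s 1 , inj₂ (1 , 1∈[1,t] , refl) , proj₂ (missing-s₁ 2) (inj₁ refl)
  fanMissing-witness (suc k@(suc (suc _))) (inj₂ (inj₂ (_ , s≤s k≤t))) =
    s k , inj₂ (k , (s≤s z≤n , k≤t) , refl) , proj₂ (missing-s k (s≤s (s≤s z≤n) , k≤t) _) refl

  module Elementarity (φ″ : Col r (s t)) (stable : Stable r (s t) φ′ t s* φ″) where
    open Backward φ″ stable
    open Typical2Inducing {ψ = φ′} {f = s*} typical′ t<Δ using (missingAt; fanMissing) renaming (elementary to elementary′)

    inFan*? : ∀ x → Dec (InV r t s* x)
    inFan*? x with x Fin.≟ r | inFan? s* t x
    ... | yes x≡r | _      = yes (inj₁ x≡r)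
    ... | no _    | yes x∈ = yes (inj₂ x∈)
    ... | no x≢r  | no x∉  = no λ { (inj₁ x≡r) → x≢r x≡r ; (inj₂ x∈) → x∉ x∈ }

    missing″→′ : ∀ {x c} → InV r t s* x → Missing φ″ x c → Missing φ′ x c
    missing″→′ {x} {c} x∈ = proj₁ (proj₁ stable x x∈ c)

    missing″→ψ : ∀ {y c} → ¬ InV r t s* y → Missing φ″ y c → Missing ψ y (π⁻¹ c)
    missing″→ψ {y} {c} y∉ m =
      proj₂ (Recoloured.missing-off-fan y (λ y≡r → y∉ (inj₁ y≡r)) (λ y∈ → y∉ (inj₂ (inFan→* y∈))) (π⁻¹ c) (from-range c (proj₁ m)))
            (subst (Missing φ″ y) (sym (Permutation.to-from colour c (proj₁ m))) m)

    inV→ : ∀ {x} → InV r t s x → InV r p s x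
    inV→ (inj₁ x≡r) = inj₁ x≡r
    inV→ (inj₂ (i , i∈ , e)) = inj₂ (i , ∈[1,p] i∈ , e)

    inner-outer : ∀ x y → InV r p s* y → InV r t s* x → ¬ InV r t s* y → ∀ c → Missing φ″ x c → Missing φ″ y c → ⊥
    inner-outer x y y∈ x∈ y∉ c mx my
      with fanMissing-witness (π⁻¹ c) (π⁻¹-fanMissing c (fanMissing (position x∈) (missingAt _ (missing″→′ x∈ mx))))
    ... | z , z∈ , mz = elementary-ψ z y (inV→ z∈) (proj₂ (sameVertices y) y∈) (λ { refl → y∉ (core* z∈) }) (π⁻¹ c)
                          (proj₂ (proj₁ stable-ψ z z∈ (π⁻¹ c)) mz) (missing″→ψ y∉ my)
      where
      core* : ∀ {w} → InV r t s w → InV r t s* w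
      core* (inj₁ w≡r) = inj₁ w≡r
      core* (inj₂ w∈) = inj₂ (inFan→* w∈)

    elementary″ : Elementary φ″ (InV r p s*)
    elementary″ x y x∈ y∈ x≢y c mx my with inFan*? x | inFan*? y
    ... | yes x∈′ | yes y∈′ = elementary′ x y x∈′ y∈′ x≢y c (missing″→′ x∈′ mx) (missing″→′ y∈′ my)
    ... | yes x∈′ | no y∉   = inner-outer x y y∈ x∈′ y∉ c mx my
    ... | no x∉   | yes y∈′ = inner-outer y x x∈ y∈′ x∉ c my mx
    ... | no x∉   | no y∉   = elementary-ψ x y (proj₂ (sameVertices x) x∈) (proj₂ (sameVertices y) y∈) x≢y (π⁻¹ c)
                                (missing″→ψ x∉ mx) (missing″→ψ y∉ my)

  pseudoMultifan′ : IsPseudoMultifan r (s t) φ′ t p s*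
  pseudoMultifan′ = record
    { t≤p = t≤p ; first = s*1≡st ; adjacent = nbr* ; distinct = dist*
    ; maximum = multifan′ , proj₂ maximum ; elementary = Elementarity.elementary″ }

  rotated : Σ (Col r (s t)) λ φ′ → Σ ℕ λ t* → Σ ℕ λ p* → Σ (ℕ → Fin n) λ s* →
              Typical2InducingPseudoMultifan r (s t) φ′ t* p* s* × (∀ x → InV r p s x ↔ InV r p* s* x)
  rotated = φ′ , t , p , s* , (pseudoMultifan′ , typical′) , sameVertices

module FromTypical {n : ℕ} (G : Graph n) (Δ : ℕ) {r s₁ : Fin n} {φ : HZ.Col G Δ r s₁} {t p α : ℕ} {s : ℕ → Fin n}
                   (PM : HZ.IsPseudoMultifan G Δ r s₁ φ t p s) (typical : HZ.Typical G Δ r s₁ φ t s α) where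
  open HZ G Δ
  open IsPseudoMultifan PM

  α∈[1,t] : InRange 1 t α
  α∈[1,t] = proj₁ typical

  missing-r : ∀ c → Missing φ r c ↔ c ≡ 1
  missing-r = proj₁ (proj₂ typical)

  missing-s₁ : ∀ c → Missing φ (s 1) c ↔ (c ≡ 2 ⊎ c ≡ Δ)
  missing-s₁ = proj₁ (proj₂ (proj₂ typical))

  middle : ∀ i → InRange 2 t i → i ≢ suc α → col φ r (s i) ≡ i × (∀ c → Missing φ (s i) c ↔ c ≡ suc i)
  middle = proj₁ (proj₂ (proj₂ (proj₂ typical)))

  last : α < t → col φ r (s (suc α)) ≡ Δ × (∀ c → Missing φ (s (suc α)) c ↔ c ≡ 2 + α)
  last = proj₂ (proj₂ (proj₂ (proj₂ typical)))

  t≥1 : 1 ≤ t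
  t≥1 = IsMultifan.p≥1 (proj₁ maximum)

  missing-s : ∀ i → InRange 2 t i → ∀ c → Missing φ (s i) c ↔ c ≡ suc i
  missing-s i i∈ with i ≟ suc α
  ... | yes refl = proj₂ (last (proj₂ i∈))
  ... | no i≢1+α = proj₂ (middle i i∈ i≢1+α)

  -- sₜ misses 1 + t and s₁ misses Δ, so elementarity of V(S) under φ itself forbids 1 + t = Δ
  1+t<Δ : 3 ≤ Δ → suc t < Δ
  1+t<Δ Δ≥3 with t ≟ 1
  ... | yes refl = Δ≥3
  ... | no t≢1 = ≤∧≢⇒< (proj₂ (proj₁ st-misses)) 1+t≢Δ
    where
    t∈[2,t] : InRange 2 t t
    t∈[2,t] = ≤∧≢⇒< t≥1 (λ e → t≢1 (sym e)) , ≤-refl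
    st-misses : Missing φ (s t) (suc t)
    st-misses = proj₂ (missing-s t t∈[2,t] (suc t)) refl
    1+t≢Δ : suc t ≢ Δ
    1+t≢Δ e = elementary φ ((λ _ _ _ → (λ m → m) , (λ m → m)) , (λ _ _ → refl)) (s t) (s 1)
                (inj₂ (t , (t≥1 , t≤p) , refl)) (inj₂ (1 , (≤-refl , ≤-trans t≥1 t≤p) , refl))
                (λ e' → t≢1 (distinct t 1 (t≥1 , t≤p) (≤-refl , ≤-trans t≥1 t≤p) e'))
                (suc t) st-misses (subst (Missing φ (s 1)) (sym e) (proj₂ (missing-s₁ Δ) (inj₂ refl)))

  typicalColouring : ∀ a → (∀ i → InRange 2 t i → col φ r (s i) ≡ fanColour Δ a i) → TypicalColouring G Δ φ t s a
  typicalColouring a colour-rs = record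
    { missing-r = missing-r ; missing-s₁ = missing-s₁ ; missing-s = missing-s ; colour-rs = colour-rs }

  colour-rs-split : α < t → ∀ i → InRange 2 t i → col φ r (s i) ≡ fanColour Δ α i
  colour-rs-split α<t i i∈ = cases (i ≟ suc α)
    where
    cases : Dec (i ≡ suc α) → col φ r (s i) ≡ fanColour Δ α i
    cases (yes i≡1+α) = subst (λ j → col φ r (s j) ≡ fanColour Δ α j) (sym i≡1+α)
                              (trans (proj₁ (last α<t)) (sym (fanColour-suc Δ α)))
    cases (no i≢1+α)  = trans (proj₁ (middle i i∈ i≢1+α))
                              (sym (fanColour-other Δ α i (λ { refl → <-irrefl refl (proj₁ i∈) }) i≢1+α))

  colour-rs-2inducing : α ≡ t → ∀ i → InRange 2 t i → col φ r (s i) ≡ fanColour Δ 0 i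
  colour-rs-2inducing refl i i∈ =
    trans (proj₁ (middle i i∈ i≢1+t)) (sym (fanColour-other Δ 0 i (λ { refl → <-irrefl refl (proj₁ i∈) }) (λ { refl → <-irrefl refl (proj₁ i∈) })))
    where
    i≢1+t : i ≢ suc t
    i≢1+t refl = <-irrefl refl (proj₂ i∈)

  rotated : 3 ≤ Δ → Σ (Col r (s t)) λ φ′ → Σ ℕ λ t* → Σ ℕ λ p* → Σ (ℕ → Fin n) λ s* →
              Typical2InducingPseudoMultifan r (s t) φ′ t* p* s* × (∀ x → InV r p s x ↔ InV r p* s* x)
  rotated Δ≥3 with α ≟ t
  ... | yes α≡t = RotatedPseudoMultifan.rotated G Δ PM (typicalColouring 0 (colour-rs-2inducing α≡t)) (1+t<Δ Δ≥3)
                    (rotation-2inducing t≥1 (1+t<Δ Δ≥3))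
  ... | no α≢t  = RotatedPseudoMultifan.rotated G Δ PM (typicalColouring α (colour-rs-split α<t)) (1+t<Δ Δ≥3)
                    (rotation-below α<t (1+t<Δ Δ≥3))
    where
    α<t : α < t
    α<t = ≤∧≢⇒< (proj₂ α∈[1,t]) α≢t

lemma3p4 : ∀ {n : ℕ} (G : Graph n) (Δ : ℕ) → IsHZGraph G Δ → 3 ≤ Δ →
           (r s₁ : Fin n) → deg G r ≡ Δ → Edge G r s₁ → deg G s₁ ≡ Δ ∸ 1 →
           (φ : HZ.Col G Δ r s₁) (t p : ℕ) (s : ℕ → Fin n) →
           HZ.TypicalPseudoMultifan G Δ r s₁ φ t p s →
           Σ (HZ.Col G Δ r (s t)) λ φ' →
           Σ ℕ λ t* → Σ ℕ λ p* → Σ (ℕ → Fin n) λ s* →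
             HZ.Typical2InducingPseudoMultifan G Δ r (s t) φ' t* p* s* ×
             (∀ x → HZ.InV G Δ r p s x ↔ HZ.InV G Δ r p* s* x)
lemma3p4 G Δ _ Δ≥3 r s₁ _ _ _ φ t p s (PM , α , typical) = FromTypical.rotated G Δ PM typical Δ≥3
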